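{- Let $f,g\in\mathbf{Z}[t]$ be coprime (in $\mathbf{Q}[t]$) polynomials of degrees $r$ and $s$, at least one positive; write $\max(r/4,s/6)=n/m$ with $n,m$ coprime positive integers, and assume $n=1$ or $m=1$. For $(a,b)\in\mathbf{Z}^2$, $b\ne0$, put $A=b^{4n}f(a/b^m)$ and $B=b^{6n}g(a/b^m)$. Let $\kappa>0$ be chosen small enough that for every $X\ge1$, every pair $(a,b)$ in the set $S_2(X)$ defined below satisfies $|A|<X^{1/3}$ and $|B|<X^{1/2}$, where $S_2(X)$ is the set of $(a,b)\in\mathbf{Z}^2$ with $a,b$ coprime, $b>0$, $|a|<\kappa X^{m/12n}$, $|b|<\kappa X^{1/12n}$, and $4A^3+27B^2\ne0$. Let $S_3(X)$ be the set of pairs $(A,B)$ arising from $(a,b)\in S_2(X)$. Let $S(X)$ be the set of $(A,B)\in\mathbf{Z}^2$ with $4A^3+27B^2\ne0$, $\gcd(A^3,B^2)$ not divisible by $e^{12}$ for any integer $e>1$, $|A|<X^{1/3}$, $|B|<X^{1/2}$, and $A=u^4f(t)$, $B=u^6g(t)$ for some $u,t\in\mathbf{Q}$. Consider the map $S_3(X)\to S(X)$, $(A,B)\mapsto(A/d^4,B/d^6)$, where $d>0$ is the largest integer with $d^{12}\mid\gcd(A^3,B^2)$. Then there is a constant $N$, independent of $X$, such that every fiber of this map has cardinality at most $N$.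
   Formalization: The constant κ and the parameter X are taken to be rational numbers. -}

module Defs where

open import Data.Nat as ℕ using (ℕ; zero; suc; _∸_)
open import Data.Integer as ℤ using (ℤ; +_)
open import Data.Integer.Divisibility as ℤD using ()
open import Data.Integer.Coprimality as ℤC using ()
open import Data.Integer.GCD as ℤG using ()
open import Data.Rational as ℚ using (ℚ; 0ℚ; 1ℚ; _÷_)
open import Data.Rational.Properties as ℚP using ()
open import Data.List using (List; []; _∷_; map)
open import Data.Product using (Σ; ∃; ∃-syntax; _×_; _,_)
open import Data.Empty using (⊥)
open import Relation.Nullary using (¬_; yes; no)
open import Relation.Binary.PropositionalEquality using (_≡_; _≢_)

-- Polynomials are coefficient lists (constant term first); trailing
-- zeros are allowed, so all notions below go through coefficients.

coeff : {A : Set} → A → List A → ℕ → A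
coeff z []       k       = z
coeff z (c ∷ cs) zero    = c
coeff z (c ∷ cs) (suc k) = coeff z cs k

coeffℤ : List ℤ → ℕ → ℤ
coeffℤ = coeff (+ 0)

coeffℚ : List ℚ → ℕ → ℚ
coeffℚ = coeff 0ℚ

HasDegree : List ℤ → ℕ → Set
HasDegree f r = (coeffℤ f r ≢ + 0) × (∀ k → r ℕ.< k → coeffℤ f k ≡ + 0)

ι : ℤ → ℚ
ι z = z ℚ./ 1

toℚ[t] : List ℤ → List ℚ
toℚ[t] = map ι

convAux : List ℚ → List ℚ → ℕ → ℕ → ℚ
convAux h p k zero    = coeffℚ h 0 ℚ.* coeffℚ p k
convAux h p k (suc i) = coeffℚ h (suc i) ℚ.* coeffℚ p (k ∸ suc i) ℚ.+ convAux h p k i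

mulCoeff : List ℚ → List ℚ → ℕ → ℚ
mulCoeff h p k = convAux h p k k

_∣ℚ[t]_ : List ℚ → List ℚ → Set
h ∣ℚ[t] F = ∃[ p ] (∀ k → mulCoeff h p k ≡ coeffℚ F k)

PositiveDegree : List ℚ → Set
PositiveDegree h = ∃[ k ] (1 ℕ.≤ k × coeffℚ h k ≢ 0ℚ)

CoprimeInℚ[t] : List ℤ → List ℤ → Set
CoprimeInℚ[t] f g = ∀ h → PositiveDegree h →
  h ∣ℚ[t] toℚ[t] f → h ∣ℚ[t] toℚ[t] g → ⊥

eval : List ℤ → ℚ → ℚ
eval []       t = 0ℚ
eval (c ∷ cs) t = (c ℚ./ 1) ℚ.+ t ℚ.* eval cs t

_^ℚ_ : ℚ → ℕ → ℚ
p ^ℚ zero  = 1ℚ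
p ^ℚ suc k = p ℚ.* (p ^ℚ k)

-- p / q, with the (irrelevant) convention p / 0 = 0
_divℚ_ : ℚ → ℚ → ℚ
p divℚ q with q ℚP.≟ 0ℚ
... | yes _  = 0ℚ
... | no q≢0 = _÷_ p q {{ℚ.≢-nonZero q≢0}}

Aval : List ℤ → ℕ → ℕ → ℤ → ℤ → ℚ
Aval f n m a b = (ι b ^ℚ (4 ℕ.* n)) ℚ.* eval f (ι a divℚ (ι b ^ℚ m))

Bval : List ℤ → ℕ → ℕ → ℤ → ℤ → ℚ
Bval g n m a b = (ι b ^ℚ (6 ℕ.* n)) ℚ.* eval g (ι a divℚ (ι b ^ℚ m))

Disc≢0 : ℤ → ℤ → Set
Disc≢0 A B = (+ 4) ℤ.* (A ℤ.^ 3) ℤ.+ (+ 27) ℤ.* (B ℤ.^ 2) ≢ + 0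

-- |A| < X^{1/3} and |B| < X^{1/2}, written as |A|^3 < X, |B|^2 < X
Bounded : ℚ → ℤ → ℤ → Set
Bounded X A B = (ι (+ ℤ.∣ A ∣) ^ℚ 3 ℚ.< X) × (ι (+ ℤ.∣ B ∣) ^ℚ 2 ℚ.< X)

-- (a,b) ∈ S₂(X):  gcd(a,b)=1, b>0, |a| < κ X^{m/12n}, |b| < κ X^{1/12n},
-- 4A³+27B² ≠ 0.  The fractional-power bounds are raised to the 12n-th power.
InS₂ : List ℤ → List ℤ → ℕ → ℕ → ℚ → ℚ → ℤ → ℤ → Set
InS₂ f g n m κ X a b =
  ℤC.Coprime a b × (+ 0 ℤ.< b) ×
  (ι (+ ℤ.∣ a ∣) ^ℚ (12 ℕ.* n) ℚ.< (κ ^ℚ (12 ℕ.* n)) ℚ.* (X ^ℚ m)) ×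
  (ι (+ ℤ.∣ b ∣) ^ℚ (12 ℕ.* n) ℚ.< (κ ^ℚ (12 ℕ.* n)) ℚ.* X) ×
  (∀ A B → ι A ≡ Aval f n m a b → ι B ≡ Bval g n m a b → Disc≢0 A B)

InS₃ : List ℤ → List ℤ → ℕ → ℕ → ℚ → ℚ → ℤ → ℤ → Set
InS₃ f g n m κ X A B = ∃[ a ] ∃[ b ]
  (InS₂ f g n m κ X a b × ι A ≡ Aval f n m a b × ι B ≡ Bval g n m a b)

InS : List ℤ → List ℤ → ℚ → ℤ → ℤ → Set
InS f g X A B =
  Disc≢0 A B ×
  (∀ (e : ℕ) → 1 ℕ.< e → ¬ ((+ e) ℤ.^ 12 ℤD.∣ ℤG.gcd (A ℤ.^ 3) (B ℤ.^ 2))) ×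
  Bounded X A B ×
  (∃[ u ] ∃[ t ] (ι A ≡ (u ^ℚ 4) ℚ.* eval f t × ι B ≡ (u ^ℚ 6) ℚ.* eval g t))

IsLargest12 : ℤ → ℤ → ℕ → Set
IsLargest12 A B d =
  (1 ℕ.≤ d) × ((+ d) ℤ.^ 12 ℤD.∣ ℤG.gcd (A ℤ.^ 3) (B ℤ.^ 2)) ×
  (∀ (e : ℕ) → 1 ℕ.≤ e → (+ e) ℤ.^ 12 ℤD.∣ ℤG.gcd (A ℤ.^ 3) (B ℤ.^ 2) → e ℕ.≤ d)

MapsTo : ℤ → ℤ → ℤ → ℤ → Set
MapsTo A B A₀ B₀ = ∃[ d ] (IsLargest12 A B d ×
  ι A₀ ≡ ι A divℚ (ι (+ d) ^ℚ 4) × ι B₀ ≡ ι B divℚ (ι (+ d) ^ℚ 6))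

module Submission where

-- A point of the fiber over (A₀, B₀) is (d⁴A₀, d⁶B₀), so it is determined by
-- its scaling factor d, and it suffices to bound d uniformly.
--  (1) f and g are coprime in ℚ[t], so the Euclidean algorithm yields
--      U, V ∈ ℤ[t] and a rational c ≠ 0 with U f + V g = c  (Bezout).
--  (2) Homogenising this identity at (a, b) writes ↥c·b^E as an integer
--      combination Aα + Bβ, so d¹² ∣ A³, B² forces d¹² ∣ |↥c|⁴·|b|ᴸ
--      (ScalingBound).
--  (3) The polynomial attaining max(r/4, s/6) = n/m has weight exactly
--      m·deg, hence its homogenisation is ≡ lc·a^deg (mod b).  As a ⊥ b, the
--      part of d¹² dividing a power of b divides a power of lc, which gives
--      d ≤ |↥c|⁴·(|lc|ᵏ)ᴸ (leading-coefficient-bound, FactorBound).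
--  (4) Distinct points of a fiber have distinct d, so a pigeonhole argument
--      bounds the fiber (fiber-bound).

open import Defs
open import Algebra.Properties.CommutativeSemigroup using (interchange)
open import Data.Nat as ℕ using (ℕ; zero; suc; _∸_)
import Data.Nat.Properties as ℕP
open import Data.Nat.Divisibility as ℕD using (_∣_)
open import Data.Nat.GCD using (gcd; gcd[m,n]∣m; gcd[m,n]∣n; gcd-greatest; gcd-zeroˡ; c*gcd[m,n]≡gcd[cm,cn])
open import Data.Nat.Coprimality using (Coprime; coprime-divisor)
open import Data.Integer as ℤ using (ℤ; +_; ∣_∣)
import Data.Integer.Properties as ℤP
import Data.Integer.Divisibility.Signed as ℤS
import Data.Integer.GCD as ℤG
import Data.Integer.Solver as ℤSolver
open import Data.Integer.Tactic.RingSolver using (solve-∀)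
open import Data.Rational as ℚ using (ℚ; 0ℚ; 1ℚ; _+_; _*_; -_; _⊔_)
import Data.Rational.Properties as ℚP
open import Data.Rational.Unnormalised as ℚᵘ using (mkℚᵘ; *≡*)
import Data.Rational.Unnormalised.Properties as ℚᵘP
import Data.Rational.Solver as ℚSolver
open import Data.Fin as Fin using (Fin; zero; suc; toℕ; fromℕ<)
open import Data.Fin.Properties using (pigeonhole; toℕ-fromℕ<)
open import Data.List using (List; []; _∷_; map; length; lookup)
open import Data.List.Membership.Propositional.Properties using (∈-lookup)
open import Data.List.Relation.Unary.All as All using (All)
open import Data.List.Relation.Unary.Unique.Propositional using (Unique; _∷_)
open import Data.Product using (∃-syntax; _×_; _,_; proj₁; proj₂)
open import Data.Sum using (_⊎_; inj₁; inj₂; [_,_]′)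
open import Data.Empty using (⊥-elim)
open import Relation.Nullary using (yes; no)
open import Relation.Binary.PropositionalEquality

-- The embedding ι : ℤ → ℚ is an injective ring homomorphism.  In the
-- unnormalised rationals ι z is literally z/1, so each fact reduces to an
-- identity of integer cross-multiplications.

toℚᵘ-ι : ∀ z → ℚ.toℚᵘ (ι z) ℚᵘ.≃ mkℚᵘ z 0
toℚᵘ-ι z = ℚP.toℚᵘ-fromℚᵘ (mkℚᵘ z 0)

ι-+ : ∀ x y → ι (x ℤ.+ y) ≡ ι x + ι y
ι-+ x y = ℚP.toℚᵘ-injective (ℚᵘP.≃-trans (toℚᵘ-ι (x ℤ.+ y))
  (ℚᵘP.≃-trans (*≡* cross) (ℚᵘP.≃-sym (ℚᵘP.≃-trans (ℚP.toℚᵘ-homo-+ (ι x) (ι y))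
                                               (ℚᵘP.+-cong (toℚᵘ-ι x) (toℚᵘ-ι y))))))
  where
  cross : (x ℤ.+ y) ℤ.* + 1 ≡ (x ℤ.* + 1 ℤ.+ y ℤ.* + 1) ℤ.* + 1
  cross = cong (ℤ._* + 1) (sym (cong₂ ℤ._+_ (ℤP.*-identityʳ x) (ℤP.*-identityʳ y)))

ι-* : ∀ x y → ι (x ℤ.* y) ≡ ι x * ι y
ι-* x y = ℚP.toℚᵘ-injective (ℚᵘP.≃-trans (toℚᵘ-ι (x ℤ.* y))
  (ℚᵘP.≃-sym (ℚᵘP.≃-trans (ℚP.toℚᵘ-homo-* (ι x) (ι y)) (ℚᵘP.*-cong (toℚᵘ-ι x) (toℚᵘ-ι y)))))

ι-injective : ∀ {x y} → ι x ≡ ι y → x ≡ y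
ι-injective {x} {y} e
  with ℚᵘP.≃-trans (ℚᵘP.≃-sym (toℚᵘ-ι x)) (ℚᵘP.≃-trans (ℚP.toℚᵘ-cong e) (toℚᵘ-ι y))
... | *≡* cross = trans (sym (ℤP.*-identityʳ x)) (trans cross (ℤP.*-identityʳ y))

ι-^ : ∀ b w → ι (b ℤ.^ w) ≡ ι b ^ℚ w
ι-^ b zero    = refl
ι-^ b (suc w) = trans (ι-* b (b ℤ.^ w)) (cong (ι b *_) (ι-^ b w))

ι-numerator : ∀ q → ι (ℚ.↥ q) ≡ ι (ℚ.↧ q) * q
ι-numerator q@(ℚ.mkℚ n d _) = ℚP.toℚᵘ-injective (ℚᵘP.≃-trans (toℚᵘ-ι n) (ℚᵘP.≃-trans (*≡* cross)
  (ℚᵘP.≃-sym (ℚᵘP.≃-trans (ℚP.toℚᵘ-homo-* (ι (+ suc d)) q)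
                          (ℚᵘP.*-cong (toℚᵘ-ι (+ suc d)) (ℚᵘP.≃-refl {mkℚᵘ n d}))))))
  where
  cross : n ℤ.* + (1 ℕ.* suc d) ≡ (+ suc d ℤ.* n) ℤ.* + 1
  cross = trans (cong (λ k → n ℤ.* + k) (ℕP.*-identityˡ (suc d)))
                (trans (ℤP.*-comm n (+ suc d)) (sym (ℤP.*-identityʳ _)))

ι-≢0 : ∀ {z} → z ≢ + 0 → ι z ≢ 0ℚ
ι-≢0 z≢0 e = z≢0 (ι-injective e)

inverseˡ : (p : ℚ) (p≢0 : p ≢ 0ℚ) → ℚ.1/_ p {{ℚ.≢-nonZero p≢0}} * p ≡ 1ℚ
inverseˡ p p≢0 = ℚP.*-inverseˡ p {{ℚ.≢-nonZero p≢0}}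

*-≢0 : ∀ {p q} → p ≢ 0ℚ → q ≢ 0ℚ → p * q ≢ 0ℚ
*-≢0 {p} {q} p≢0 q≢0 pq≡0 = p≢0 (begin
  p                  ≡⟨ sym (ℚP.*-identityʳ p) ⟩
  p * 1ℚ             ≡⟨ cong (p *_) (sym (inverseˡ q q≢0)) ⟩
  p * (q⁻¹ * q)      ≡⟨ reassoc p q⁻¹ q ⟩
  (p * q) * q⁻¹      ≡⟨ cong (_* q⁻¹) pq≡0 ⟩
  0ℚ * q⁻¹           ≡⟨ ℚP.*-zeroˡ q⁻¹ ⟩
  0ℚ                 ∎)
  where
  open ≡-Reasoning
  open ℚSolver.+-*-Solver
  q⁻¹ = ℚ.1/_ q {{ℚ.≢-nonZero q≢0}}
  reassoc : ∀ a b c → a * (b * c) ≡ (a * c) * b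
  reassoc = solve 3 (λ a b c → a :* (b :* c) := (a :* c) :* b) refl

^ℚ-≢0 : ∀ {x} k → x ≢ 0ℚ → x ^ℚ k ≢ 0ℚ
^ℚ-≢0 zero    x≢0 ()
^ℚ-≢0 (suc k) x≢0 = *-≢0 x≢0 (^ℚ-≢0 k x≢0)

^ℚ-+ : ∀ x i j → x ^ℚ (i ℕ.+ j) ≡ x ^ℚ i * x ^ℚ j
^ℚ-+ x zero    j = sym (ℚP.*-identityˡ (x ^ℚ j))
^ℚ-+ x (suc i) j = trans (cong (x *_) (^ℚ-+ x i j)) (sym (ℚP.*-assoc x (x ^ℚ i) (x ^ℚ j)))

divℚ-cancel : ∀ p q → q ≢ 0ℚ → q * (p divℚ q) ≡ p
divℚ-cancel p q q≢0 with q ℚP.≟ 0ℚ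
... | yes q≡0 = ⊥-elim (q≢0 q≡0)
... | no q≢0' = begin
  q * (p * q⁻¹)   ≡⟨ solve 3 (λ q p i → q :* (p :* i) := p :* (i :* q)) refl q p q⁻¹ ⟩
  p * (q⁻¹ * q)   ≡⟨ cong (p *_) (inverseˡ q q≢0') ⟩
  p * 1ℚ          ≡⟨ ℚP.*-identityʳ p ⟩
  p               ∎
  where
  open ≡-Reasoning
  open ℚSolver.+-*-Solver
  q⁻¹ = ℚ.1/_ q {{ℚ.≢-nonZero q≢0'}}

-- Polynomials over ℚ as coefficient lists, compared coefficientwise
-- (trailing zeros are irrelevant).  Multiplication recurses on its left
-- factor; its coefficients are the convolution mulCoeff of Defs, which is
-- how the ring laws that involve the right factor are proved.
module Polynomials where
  open ℚSolver.+-*-Solver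

  Poly : Set
  Poly = List ℚ

  infix 4 _≈_
  record _≈_ (p q : Poly) : Set where
    constructor mk≈
    field at : ∀ k → coeffℚ p k ≡ coeffℚ q k
  open _≈_ public

  ≈-refl : ∀ {p} → p ≈ p
  ≈-refl = mk≈ λ _ → refl

  ≈-sym : ∀ {p q} → p ≈ q → q ≈ p
  ≈-sym e = mk≈ λ k → sym (at e k)

  ≈-trans : ∀ {p q r} → p ≈ q → q ≈ r → p ≈ r
  ≈-trans e e′ = mk≈ λ k → trans (at e k) (at e′ k)

  addP : Poly → Poly → Poly
  addP []       q        = q
  addP (x ∷ p)  []       = x ∷ p
  addP (x ∷ p)  (y ∷ q)  = (x + y) ∷ addP p q

  scaleP : ℚ → Poly → Poly
  scaleP c []      = []
  scaleP c (x ∷ p) = c * x ∷ scaleP c p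

  subP : Poly → Poly → Poly
  subP p q = addP p (scaleP (- 1ℚ) q)

  mulP : Poly → Poly → Poly
  mulP []       q = []
  mulP (c ∷ cs) q = addP (scaleP c q) (0ℚ ∷ mulP cs q)

  shift : ℕ → Poly → Poly
  shift zero    p = p
  shift (suc j) p = 0ℚ ∷ shift j p

  monomial : ℕ → ℚ → Poly
  monomial j c = shift j (c ∷ [])

  evalP : Poly → ℚ → ℚ
  evalP []       t = 0ℚ
  evalP (c ∷ cs) t = c + t * evalP cs t

  coeff-[] : ∀ k → coeffℚ [] k ≡ 0ℚ
  coeff-[] zero    = refl
  coeff-[] (suc k) = refl

  coeff-add : ∀ p q k → coeffℚ (addP p q) k ≡ coeffℚ p k + coeffℚ q k
  coeff-add []      q       k       = sym (trans (cong (_+ coeffℚ q k) (coeff-[] k)) (ℚP.+-identityˡ _))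
  coeff-add (x ∷ p) []      k       = sym (trans (cong (_+_ (coeffℚ (x ∷ p) k)) (coeff-[] k)) (ℚP.+-identityʳ _))
  coeff-add (x ∷ p) (y ∷ q) zero    = refl
  coeff-add (x ∷ p) (y ∷ q) (suc k) = coeff-add p q k

  coeff-scale : ∀ c p k → coeffℚ (scaleP c p) k ≡ c * coeffℚ p k
  coeff-scale c []      k       = trans (coeff-[] k) (sym (trans (cong (c *_) (coeff-[] k)) (ℚP.*-zeroʳ c)))
  coeff-scale c (x ∷ p) zero    = refl
  coeff-scale c (x ∷ p) (suc k) = coeff-scale c p k

  coeff-sub : ∀ p q k → coeffℚ (subP p q) k ≡ coeffℚ p k + (- 1ℚ) * coeffℚ q k
  coeff-sub p q k = trans (coeff-add p _ k) (cong (_+_ (coeffℚ p k)) (coeff-scale (- 1ℚ) q k))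

  convAux-[] : ∀ q k i → convAux [] q k i ≡ 0ℚ
  convAux-[] q k zero    = ℚP.*-zeroˡ (coeffℚ q k)
  convAux-[] q k (suc i) = cong₂ _+_ (ℚP.*-zeroˡ (coeffℚ q (k ∸ suc i))) (convAux-[] q k i)

  convAux-∷ : ∀ c cs q k i →
    convAux (c ∷ cs) q (suc k) (suc i) ≡ c * coeffℚ q (suc k) + convAux cs q k i
  convAux-∷ c cs q k zero    = ℚP.+-comm (coeffℚ cs 0 * coeffℚ q k) (c * coeffℚ q (suc k))
  convAux-∷ c cs q k (suc i) =
    trans (cong (_+_ (coeffℚ cs (suc i) * coeffℚ q (k ∸ suc i))) (convAux-∷ c cs q k i))
          (swap (coeffℚ cs (suc i) * coeffℚ q (k ∸ suc i)) (c * coeffℚ q (suc k)) (convAux cs q k i))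
    where
    swap : ∀ a b d → a + (b + d) ≡ b + (a + d)
    swap = solve 3 (λ a b d → a :+ (b :+ d) := b :+ (a :+ d)) refl

  coeff-mul : ∀ p q k → coeffℚ (mulP p q) k ≡ mulCoeff p q k
  coeff-mul []       q k       = trans (coeff-[] k) (sym (convAux-[] q k k))
  coeff-mul (c ∷ cs) q zero    =
    trans (coeff-add (scaleP c q) _ 0)
          (trans (cong (_+ 0ℚ) (coeff-scale c q 0)) (ℚP.+-identityʳ (c * coeffℚ q 0)))
  coeff-mul (c ∷ cs) q (suc k) = begin
    coeffℚ (addP (scaleP c q) (0ℚ ∷ mulP cs q)) (suc k)  ≡⟨ coeff-add (scaleP c q) _ (suc k) ⟩
    coeffℚ (scaleP c q) (suc k) + coeffℚ (mulP cs q) k    ≡⟨ cong₂ _+_ (coeff-scale c q (suc k)) (coeff-mul cs q k) ⟩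
    c * coeffℚ q (suc k) + convAux cs q k k               ≡⟨ sym (convAux-∷ c cs q k k) ⟩
    convAux (c ∷ cs) q (suc k) (suc k)                    ∎
    where open ≡-Reasoning

  convAux-congʳ : ∀ h u v k i → u ≈ v → convAux h u k i ≡ convAux h v k i
  convAux-congʳ h u v k zero    e = cong (coeffℚ h 0 *_) (at e k)
  convAux-congʳ h u v k (suc i) e =
    cong₂ _+_ (cong (coeffℚ h (suc i) *_) (at e (k ∸ suc i))) (convAux-congʳ h u v k i e)

  convAux-addʳ : ∀ h u v k i → convAux h (addP u v) k i ≡ convAux h u k i + convAux h v k i
  convAux-addʳ h u v k zero    =
    trans (cong (coeffℚ h 0 *_) (coeff-add u v k)) (ℚP.*-distribˡ-+ (coeffℚ h 0) (coeffℚ u k) (coeffℚ v k))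
  convAux-addʳ h u v k (suc i) =
    trans (cong₂ _+_ (cong (coeffℚ h (suc i) *_) (coeff-add u v (k ∸ suc i))) (convAux-addʳ h u v k i))
          (regroup (coeffℚ h (suc i)) (coeffℚ u (k ∸ suc i)) (coeffℚ v (k ∸ suc i))
                   (convAux h u k i) (convAux h v k i))
    where
    regroup : ∀ a b c d e → a * (b + c) + (d + e) ≡ (a * b + d) + (a * c + e)
    regroup = solve 5 (λ a b c d e → a :* (b :+ c) :+ (d :+ e) := (a :* b :+ d) :+ (a :* c :+ e)) refl

  convAux-addˡ : ∀ u v q k i → convAux (addP u v) q k i ≡ convAux u q k i + convAux v q k i
  convAux-addˡ u v q k zero    =
    trans (cong (_* coeffℚ q k) (coeff-add u v 0)) (ℚP.*-distribʳ-+ (coeffℚ q k) (coeffℚ u 0) (coeffℚ v 0))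
  convAux-addˡ u v q k (suc i) =
    trans (cong₂ _+_ (cong (_* coeffℚ q (k ∸ suc i)) (coeff-add u v (suc i))) (convAux-addˡ u v q k i))
          (regroup (coeffℚ q (k ∸ suc i)) (coeffℚ u (suc i)) (coeffℚ v (suc i))
                   (convAux u q k i) (convAux v q k i))
    where
    regroup : ∀ a b c d e → (b + c) * a + (d + e) ≡ (b * a + d) + (c * a + e)
    regroup = solve 5 (λ a b c d e → (b :+ c) :* a :+ (d :+ e) := (b :* a :+ d) :+ (c :* a :+ e)) refl

  convAux-scaleʳ : ∀ h c u k i → convAux h (scaleP c u) k i ≡ c * convAux h u k i
  convAux-scaleʳ h c u k zero    =
    trans (cong (coeffℚ h 0 *_) (coeff-scale c u k)) (swap (coeffℚ h 0) c (coeffℚ u k))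
    where
    swap : ∀ a b d → a * (b * d) ≡ b * (a * d)
    swap = solve 3 (λ a b d → a :* (b :* d) := b :* (a :* d)) refl
  convAux-scaleʳ h c u k (suc i) =
    trans (cong₂ _+_ (cong (coeffℚ h (suc i) *_) (coeff-scale c u (k ∸ suc i))) (convAux-scaleʳ h c u k i))
          (factor (coeffℚ h (suc i)) c (coeffℚ u (k ∸ suc i)) (convAux h u k i))
    where
    factor : ∀ a b d e → a * (b * d) + b * e ≡ b * (a * d + e)
    factor = solve 4 (λ a b d e → a :* (b :* d) :+ b :* e := b :* (a :* d :+ e)) refl

  add-cong : ∀ {p p′ q q′} → p ≈ p′ → q ≈ q′ → addP p q ≈ addP p′ q′
  add-cong {p} {p′} {q} {q′} e e′ = mk≈ λ k →
    trans (coeff-add p q k) (trans (cong₂ _+_ (at e k) (at e′ k)) (sym (coeff-add p′ q′ k)))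

  cons-cong : ∀ x {p p′} → p ≈ p′ → (x ∷ p) ≈ (x ∷ p′)
  cons-cong x e = mk≈ λ { zero → refl ; (suc k) → at e k }

  mul-congʳ : ∀ h {u v} → u ≈ v → mulP h u ≈ mulP h v
  mul-congʳ h {u} {v} e = mk≈ λ k →
    trans (coeff-mul h u k) (trans (convAux-congʳ h u v k k e) (sym (coeff-mul h v k)))

  mul-addʳ : ∀ h u v → mulP h (addP u v) ≈ addP (mulP h u) (mulP h v)
  mul-addʳ h u v = mk≈ λ k → trans (coeff-mul h _ k) (trans (convAux-addʳ h u v k k)
    (sym (trans (coeff-add (mulP h u) _ k) (cong₂ _+_ (coeff-mul h u k) (coeff-mul h v k)))))

  mul-addˡ : ∀ u v q → mulP (addP u v) q ≈ addP (mulP u q) (mulP v q)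
  mul-addˡ u v q = mk≈ λ k → trans (coeff-mul _ q k) (trans (convAux-addˡ u v q k k)
    (sym (trans (coeff-add (mulP u q) _ k) (cong₂ _+_ (coeff-mul u q k) (coeff-mul v q k)))))

  mul-scaleʳ : ∀ h c u → mulP h (scaleP c u) ≈ scaleP c (mulP h u)
  mul-scaleʳ h c u = mk≈ λ k → trans (coeff-mul h _ k) (trans (convAux-scaleʳ h c u k k)
    (sym (trans (coeff-scale c (mulP h u) k) (cong (c *_) (coeff-mul h u k)))))

  mul-[]ʳ : ∀ h → mulP h [] ≈ []
  mul-[]ʳ []       = ≈-refl
  mul-[]ʳ (c ∷ cs) = mk≈ λ { zero → ℚP.+-identityʳ _ ; (suc k) → at (mul-[]ʳ cs) k }

  mul-shiftʳ : ∀ h u → mulP h (0ℚ ∷ u) ≈ (0ℚ ∷ mulP h u)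
  mul-shiftʳ []       u = mk≈ λ { zero → refl ; (suc k) → refl }
  mul-shiftʳ (c ∷ cs) u = mk≈ λ
    { zero    → trans (ℚP.+-identityʳ (c * 0ℚ)) (ℚP.*-zeroʳ c)
    ; (suc k) → trans (coeff-add (scaleP c u) (mulP cs (0ℚ ∷ u)) k)
                 (trans (cong (_+_ (coeffℚ (scaleP c u) k)) (at (mul-shiftʳ cs u) k))
                        (sym (coeff-add (scaleP c u) (0ℚ ∷ mulP cs u) k))) }

  -- left commutativity h(qp) ≈ q(hp), by induction on h; with the unit it
  -- gives commutativity, and it moves a divisor past a quotient in Euclid
  mul-leftcomm : ∀ h q p → mulP h (mulP q p) ≈ mulP q (mulP h p)
  mul-leftcomm []       q p = ≈-sym (mul-[]ʳ q)
  mul-leftcomm (c ∷ cs) q p = ≈-sym (≈-trans (mul-addʳ q (scaleP c p) (0ℚ ∷ mulP cs p))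
    (add-cong (mul-scaleʳ q c p)
              (≈-trans (mul-shiftʳ q (mulP cs p)) (cons-cong 0ℚ (≈-sym (mul-leftcomm cs q p))))))

  mul-oneʳ : ∀ p → mulP p (1ℚ ∷ []) ≈ p
  mul-oneʳ []       = ≈-refl
  mul-oneʳ (c ∷ cs) = mk≈ λ
    { zero    → trans (ℚP.+-identityʳ (c * 1ℚ)) (ℚP.*-identityʳ c)
    ; (suc k) → at (mul-oneʳ cs) k }

  mul-comm : ∀ h p → mulP h p ≈ mulP p h
  mul-comm h p = ≈-trans (mul-congʳ h (≈-sym (mul-oneʳ p)))
                         (≈-trans (mul-leftcomm h p (1ℚ ∷ [])) (mul-congʳ p (mul-oneʳ h)))

  coeff-shift : ∀ j p k → j ℕ.≤ k → coeffℚ (shift j p) k ≡ coeffℚ p (k ∸ j)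
  coeff-shift zero    p k       _          = refl
  coeff-shift (suc j) p (suc k) (ℕ.s≤s le) = coeff-shift j p k le

  mul-monomial : ∀ j c y → mulP (monomial j c) y ≈ shift j (scaleP c y)
  mul-monomial zero    c y = mk≈ λ k →
    trans (coeff-add (scaleP c y) (0ℚ ∷ []) k)
          (trans (cong (_+_ (coeffℚ (scaleP c y) k)) (coeff-0 k)) (ℚP.+-identityʳ _))
    where
    coeff-0 : ∀ k → coeffℚ (0ℚ ∷ []) k ≡ 0ℚ
    coeff-0 zero    = refl
    coeff-0 (suc k) = refl
  mul-monomial (suc j) c y = mk≈ λ k →
    trans (coeff-add (scaleP 0ℚ y) _ k)
          (trans (cong₂ _+_ (trans (coeff-scale 0ℚ y k) (ℚP.*-zeroˡ (coeffℚ y k))) refl)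
                 (trans (ℚP.+-identityˡ _) (at (cons-cong 0ℚ (mul-monomial j c y)) k)))

  coeff-mul-monomial : ∀ j c y k → j ℕ.≤ k → coeffℚ (mulP (monomial j c) y) k ≡ c * coeffℚ y (k ∸ j)
  coeff-mul-monomial j c y k j≤k =
    trans (at (mul-monomial j c y) k) (trans (coeff-shift j (scaleP c y) k j≤k) (coeff-scale c y (k ∸ j)))

  eval-add : ∀ p q t → evalP (addP p q) t ≡ evalP p t + evalP q t
  eval-add []      q       t = sym (ℚP.+-identityˡ (evalP q t))
  eval-add (x ∷ p) []      t = sym (ℚP.+-identityʳ (x + t * evalP p t))
  eval-add (x ∷ p) (y ∷ q) t =
    trans (cong (λ z → x + y + t * z) (eval-add p q t)) (regroup x y t (evalP p t) (evalP q t))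
    where
    regroup : ∀ x y t a b → x + y + t * (a + b) ≡ x + t * a + (y + t * b)
    regroup = solve 5 (λ x y t a b → x :+ y :+ t :* (a :+ b) := x :+ t :* a :+ (y :+ t :* b)) refl

  eval-scale : ∀ c p t → evalP (scaleP c p) t ≡ c * evalP p t
  eval-scale c []      t = sym (ℚP.*-zeroʳ c)
  eval-scale c (x ∷ p) t =
    trans (cong (λ z → c * x + t * z) (eval-scale c p t)) (factor c x t (evalP p t))
    where
    factor : ∀ c x t a → c * x + t * (c * a) ≡ c * (x + t * a)
    factor = solve 4 (λ c x t a → c :* x :+ t :* (c :* a) := c :* (x :+ t :* a)) refl

  eval-sub : ∀ p q t → evalP (subP p q) t ≡ evalP p t + (- 1ℚ) * evalP q t
  eval-sub p q t = trans (eval-add p _ t) (cong (_+_ (evalP p t)) (eval-scale (- 1ℚ) q t))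

  eval-mul : ∀ p q t → evalP (mulP p q) t ≡ evalP p t * evalP q t
  eval-mul []       q t = sym (ℚP.*-zeroˡ (evalP q t))
  eval-mul (c ∷ cs) q t = begin
    evalP (addP (scaleP c q) (0ℚ ∷ mulP cs q)) t             ≡⟨ eval-add (scaleP c q) _ t ⟩
    evalP (scaleP c q) t + (0ℚ + t * evalP (mulP cs q) t)    ≡⟨ cong₂ (λ a b → a + (0ℚ + t * b)) (eval-scale c q t) (eval-mul cs q t) ⟩
    c * evalP q t + (0ℚ + t * (evalP cs t * evalP q t))      ≡⟨ factor c t (evalP cs t) (evalP q t) ⟩
    (c + t * evalP cs t) * evalP q t                         ∎
    where
    open ≡-Reasoning
    factor : ∀ c t a b → c * b + (0ℚ + t * (a * b)) ≡ (c + t * a) * b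
    factor = solve 4 (λ c t a b → c :* b :+ (con 0ℚ :+ t :* (a :* b)) := (c :+ t :* a) :* b) refl

  eval-zero : ∀ p t → (∀ k → coeffℚ p k ≡ 0ℚ) → evalP p t ≡ 0ℚ
  eval-zero []       t z = refl
  eval-zero (c ∷ cs) t z =
    trans (cong₂ (λ a b → a + t * b) (z 0) (eval-zero cs t (λ k → z (suc k))))
          (trans (ℚP.+-identityˡ (t * 0ℚ)) (ℚP.*-zeroʳ t))

open Polynomials

module Euclidean where
  open ℚSolver.+-*-Solver

  Bound : Poly → ℕ → Set
  Bound p B = ∀ k → B ℕ.≤ k → coeffℚ p k ≡ 0ℚ

  Deg : Poly → ℕ → Set
  Deg p d = (coeffℚ p d ≢ 0ℚ) × (∀ k → d ℕ.< k → coeffℚ p k ≡ 0ℚ)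

  Bound-≈ : ∀ {p q} B → p ≈ q → Bound p B → Bound q B
  Bound-≈ B e b k le = trans (sym (at e k)) (b k le)

  Bound-length : ∀ p → Bound p (length p)
  Bound-length []      k       _          = coeff-[] k
  Bound-length (x ∷ p) (suc k) (ℕ.s≤s le) = Bound-length p k le

  degree : ∀ B r → Bound r B → (∀ k → coeffℚ r k ≡ 0ℚ) ⊎ ∃[ d ] (d ℕ.< B × Deg r d)
  degree zero     r b = inj₁ (λ k → b k ℕ.z≤n)
  degree (suc B′) r b with coeffℚ r B′ ℚP.≟ 0ℚ
  ... | no  r≢0 = inj₂ (B′ , ℕP.≤-refl , r≢0 , b)
  ... | yes r≡0 with degree B′ r lower
    where
    lower : Bound r B′
    lower k le with ℕP.m≤n⇒m<n∨m≡n le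
    ... | inj₁ lt   = b k lt
    ... | inj₂ refl = r≡0
  ...   | inj₁ vanishes       = inj₁ vanishes
  ...   | inj₂ (d , d<B′ , dg) = inj₂ (d , ℕP.m≤n⇒m≤1+n d<B′ , dg)

  sub-[] : ∀ x → subP x [] ≈ x
  sub-[] x = mk≈ λ k → trans (coeff-sub x [] k)
    (trans (cong (λ z → coeffℚ x k + (- 1ℚ) * z) (coeff-[] k))
           (solve 1 (λ a → a :+ con (- 1ℚ) :* con 0ℚ := a) refl (coeffℚ x k)))

  sub-add : ∀ x u v y → subP x (mulP (addP u v) y) ≈ subP (subP x (mulP u y)) (mulP v y)
  sub-add x u v y = mk≈ λ k → begin
    coeffℚ (subP x (mulP (addP u v) y)) k
      ≡⟨ coeff-sub x _ k ⟩
    coeffℚ x k + (- 1ℚ) * coeffℚ (mulP (addP u v) y) k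
      ≡⟨ cong (λ z → coeffℚ x k + (- 1ℚ) * z) (trans (at (mul-addˡ u v y) k) (coeff-add (mulP u y) _ k)) ⟩
    coeffℚ x k + (- 1ℚ) * (coeffℚ (mulP u y) k + coeffℚ (mulP v y) k)
      ≡⟨ regroup (coeffℚ x k) (coeffℚ (mulP u y) k) (coeffℚ (mulP v y) k) ⟩
    (coeffℚ x k + (- 1ℚ) * coeffℚ (mulP u y) k) + (- 1ℚ) * coeffℚ (mulP v y) k
      ≡⟨ sym (trans (coeff-sub (subP x (mulP u y)) _ k) (cong (_+ (- 1ℚ) * coeffℚ (mulP v y) k) (coeff-sub x _ k))) ⟩
    coeffℚ (subP (subP x (mulP u y)) (mulP v y)) k
      ∎
    where
    open ≡-Reasoning
    regroup : ∀ a b c → a + (- 1ℚ) * (b + c) ≡ (a + (- 1ℚ) * b) + (- 1ℚ) * c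
    regroup = solve 3 (λ a b c → a :+ con (- 1ℚ) :* (b :+ c) := (a :+ con (- 1ℚ) :* b) :+ con (- 1ℚ) :* c) refl

  sub≡0⇒≈ : ∀ a b → (∀ k → coeffℚ (subP a b) k ≡ 0ℚ) → a ≈ b
  sub≡0⇒≈ a b z = mk≈ λ k → begin
    coeffℚ a k                                          ≡⟨ split (coeffℚ a k) (coeffℚ b k) ⟩
    (coeffℚ a k + (- 1ℚ) * coeffℚ b k) + coeffℚ b k     ≡⟨ cong (_+ coeffℚ b k) (trans (sym (coeff-sub a b k)) (z k)) ⟩
    0ℚ + coeffℚ b k                                     ≡⟨ ℚP.+-identityˡ (coeffℚ b k) ⟩
    coeffℚ b k                                          ∎
    where
    open ≡-Reasoning
    split : ∀ a b → a ≡ (a + (- 1ℚ) * b) + b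
    split = solve 2 (λ a b → a := (a :+ con (- 1ℚ) :* b) :+ b) refl

  add-sub : ∀ a b → addP b (subP a b) ≈ a
  add-sub a b = mk≈ λ k → trans (coeff-add b (subP a b) k) (trans (cong (_+_ (coeffℚ b k)) (coeff-sub a b k))
    (solve 2 (λ a b → b :+ (a :+ con (- 1ℚ) :* b) := a) refl (coeffℚ a k) (coeffℚ b k)))

  module Division (y : Poly) (dy : ℕ) (deg-y : Deg y dy) where
    lc : ℚ
    lc = coeffℚ y dy

    lc⁻¹ : ℚ
    lc⁻¹ = ℚ.1/_ lc {{ℚ.≢-nonZero (proj₁ deg-y)}}

    leadQuot : Poly → ℕ → Poly
    leadQuot x B′ = monomial (B′ ∸ dy) (coeffℚ x B′ * lc⁻¹)

    cancel-top : ∀ B′ x → dy ℕ.≤ B′ → Bound x (suc B′) → Bound (subP x (mulP (leadQuot x B′) y)) B′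
    cancel-top B′ x dy≤B′ bx k B′≤k = trans (coeff-sub x _ k) (case (ℕP.m≤n⇒m<n∨m≡n B′≤k))
      where
      j = B′ ∸ dy
      c = coeffℚ x B′ * lc⁻¹
      j≤k = ℕP.≤-trans (ℕP.m∸n≤m B′ dy) B′≤k
      product = coeff-mul-monomial j c y k j≤k
      case : B′ ℕ.< k ⊎ B′ ≡ k → coeffℚ x k + (- 1ℚ) * coeffℚ (mulP (leadQuot x B′) y) k ≡ 0ℚ
      case (inj₂ refl) = begin
        coeffℚ x B′ + (- 1ℚ) * coeffℚ (mulP (leadQuot x B′) y) B′
          ≡⟨ cong (λ z → coeffℚ x B′ + (- 1ℚ) * z) (trans product (cong (λ i → c * coeffℚ y i) (ℕP.m∸[m∸n]≡n dy≤B′))) ⟩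
        coeffℚ x B′ + (- 1ℚ) * ((coeffℚ x B′ * lc⁻¹) * lc)
          ≡⟨ cong (λ z → coeffℚ x B′ + (- 1ℚ) * z) (trans (ℚP.*-assoc (coeffℚ x B′) lc⁻¹ lc)
               (trans (cong (coeffℚ x B′ *_) (inverseˡ lc (proj₁ deg-y))) (ℚP.*-identityʳ (coeffℚ x B′)))) ⟩
        coeffℚ x B′ + (- 1ℚ) * coeffℚ x B′
          ≡⟨ solve 1 (λ a → a :+ con (- 1ℚ) :* a := con 0ℚ) refl (coeffℚ x B′) ⟩
        0ℚ
          ∎
        where open ≡-Reasoning
      case (inj₁ B′<k) = begin
        coeffℚ x k + (- 1ℚ) * coeffℚ (mulP (leadQuot x B′) y) k
          ≡⟨ cong₂ (λ a z → a + (- 1ℚ) * z) (bx k B′<k) (trans product (cong (c *_) (proj₂ deg-y (k ∸ j) dy<k-j))) ⟩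
        0ℚ + (- 1ℚ) * (c * 0ℚ)
          ≡⟨ solve 1 (λ a → con 0ℚ :+ con (- 1ℚ) :* (a :* con 0ℚ) := con 0ℚ) refl c ⟩
        0ℚ
          ∎
        where
        open ≡-Reasoning
        dy<k-j : dy ℕ.< k ∸ j
        dy<k-j = subst (ℕ._< k ∸ j) (ℕP.m∸[m∸n]≡n dy≤B′) (ℕP.∸-monoˡ-< B′<k (ℕP.m∸n≤m B′ dy))

    divide : ∀ B x → Bound x B → ∃[ q ] Bound (subP x (mulP q y)) dy
    divide zero     x bx = [] , Bound-≈ dy (≈-sym (sub-[] x)) (λ k _ → bx k ℕ.z≤n)
    divide (suc B′) x bx with dy ℕ.≤? B′
    ... | no  dy≰B′ = [] , Bound-≈ dy (≈-sym (sub-[] x)) (λ k le → bx k (ℕP.≤-trans (ℕP.≰⇒> dy≰B′) le))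
    ... | yes dy≤B′ with divide B′ (subP x (mulP (leadQuot x B′) y)) (cancel-top B′ x dy≤B′ bx)
    ...   | q , bq = addP (leadQuot x B′) q , Bound-≈ dy (≈-sym (sub-add x (leadQuot x B′) q y)) bq

  Divides : Poly → Poly → Set
  Divides h X = ∃[ p ] (mulP h p ≈ X)

  -- The Euclidean algorithm on (F, G), tracking two invariants of each pair
  -- (x, y) of consecutive remainders: common divisors of x and y divide F and
  -- G, and x, y are ℚ[t]-combinations of F and G (checked pointwise).
  module Euclid (F G : Poly) where
    DivisorsDescend : Poly → Poly → Set
    DivisorsDescend x y = ∀ h → Divides h x → Divides h y → Divides h F × Divides h G

    Combination : Poly → Set
    Combination x = ∃[ U ] ∃[ V ] (∀ t → evalP U t * evalP F t + evalP V t * evalP G t ≡ evalP x t)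

    GcdCertificate : Set
    GcdCertificate = ∃[ h ] ∃[ dh ] (Deg h dh × Divides h F × Divides h G × Combination h)

    combination-step : ∀ x y q → Combination x → Combination y → Combination (subP x (mulP q y))
    combination-step x y q (Ux , Vx , ex) (Uy , Vy , ey) = subP Ux (mulP q Uy) , subP Vx (mulP q Vy) , λ t → begin
        evalP (subP Ux (mulP q Uy)) t * evalP F t + evalP (subP Vx (mulP q Vy)) t * evalP G t
      ≡⟨ cong₂ (λ a b → a * evalP F t + b * evalP G t) (eval-sub-mul Ux q Uy t) (eval-sub-mul Vx q Vy t) ⟩
        (evalP Ux t + (- 1ℚ) * (evalP q t * evalP Uy t)) * evalP F t + (evalP Vx t + (- 1ℚ) * (evalP q t * evalP Vy t)) * evalP G t
      ≡⟨ regroup (evalP Ux t) (evalP Uy t) (evalP Vx t) (evalP Vy t) (evalP q t) (evalP F t) (evalP G t) ⟩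
        (evalP Ux t * evalP F t + evalP Vx t * evalP G t) + (- 1ℚ) * (evalP q t * (evalP Uy t * evalP F t + evalP Vy t * evalP G t))
      ≡⟨ cong₂ (λ a b → a + (- 1ℚ) * (evalP q t * b)) (ex t) (ey t) ⟩
        evalP x t + (- 1ℚ) * (evalP q t * evalP y t)
      ≡⟨ sym (eval-sub-mul x q y t) ⟩
        evalP (subP x (mulP q y)) t
      ∎
      where
      open ≡-Reasoning
      eval-sub-mul : ∀ a q b t → evalP (subP a (mulP q b)) t ≡ evalP a t + (- 1ℚ) * (evalP q t * evalP b t)
      eval-sub-mul a q b t = trans (eval-sub a _ t) (cong (λ z → evalP a t + (- 1ℚ) * z) (eval-mul q b t))
      regroup : ∀ ux uy vx vy q f g →
        (ux + (- 1ℚ) * (q * uy)) * f + (vx + (- 1ℚ) * (q * vy)) * g ≡ (ux * f + vx * g) + (- 1ℚ) * (q * (uy * f + vy * g))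
      regroup = solve 7 (λ ux uy vx vy q f g →
        (ux :+ con (- 1ℚ) :* (q :* uy)) :* f :+ (vx :+ con (- 1ℚ) :* (q :* vy)) :* g
          := (ux :* f :+ vx :* g) :+ con (- 1ℚ) :* (q :* (uy :* f :+ vy :* g))) refl

    divisors-step : ∀ x y q → DivisorsDescend x y → DivisorsDescend y (subP x (mulP q y))
    divisors-step x y q descend h (p₁ , hp₁≈y) (p₂ , hp₂≈r) = descend h (addP (mulP q p₁) p₂ , hp≈x) (p₁ , hp₁≈y)
      where
      hp≈x : mulP h (addP (mulP q p₁) p₂) ≈ x
      hp≈x = ≈-trans (mul-addʳ h (mulP q p₁) p₂)
               (≈-trans (add-cong (≈-trans (mul-leftcomm h q p₁) (mul-congʳ q hp₁≈y)) hp₂≈r) (add-sub x (mulP q y)))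

    -- the remainder sequence has strictly decreasing degrees, so fuel dy+1 suffices
    euclid : ∀ fuel x y dy → dy ℕ.< fuel → Deg y dy →
      DivisorsDescend x y → Combination x → Combination y → GcdCertificate
    euclid (suc fuel) x y dy dy<fuel deg-y descend comb-x comb-y
      with Division.divide y dy deg-y (length x) x (Bound-length x)
    ... | q , bound-r with degree dy (subP x (mulP q y)) bound-r
    ...   | inj₁ r≡0 = y , dy , deg-y , proj₁ y∣F,G , proj₂ y∣F,G , comb-y
      where
      y∣x : Divides y x
      y∣x = q , ≈-trans (mul-comm y q) (≈-sym (sub≡0⇒≈ x (mulP q y) r≡0))
      y∣F,G : Divides y F × Divides y G
      y∣F,G = descend y y∣x (1ℚ ∷ [] , mul-oneʳ y)
    ...   | inj₂ (dr , dr<dy , deg-r) =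
      euclid fuel y (subP x (mulP q y)) dr (ℕP.<-≤-trans dr<dy (ℕP.≤-pred dy<fuel)) deg-r
             (divisors-step x y q descend) comb-y (combination-step x y q comb-x comb-y)

open Euclidean

-- It is first obtained over ℚ from the
-- Euclidean algorithm (the last nonzero remainder is a combination of f and
-- g dividing both, hence constant by coprimality), then denominators are
-- cleared.
module Bezout where
  open ℚSolver.+-*-Solver

  eval-toℚ[t] : ∀ f t → eval f t ≡ evalP (toℚ[t] f) t
  eval-toℚ[t] []       t = refl
  eval-toℚ[t] (c ∷ cs) t = cong (λ z → ι c + t * z) (eval-toℚ[t] cs t)

  coeff-toℚ[t] : ∀ f k → coeffℚ (toℚ[t] f) k ≡ ι (coeffℤ f k)
  coeff-toℚ[t] []       zero    = refl
  coeff-toℚ[t] []       (suc k) = refl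
  coeff-toℚ[t] (c ∷ cs) zero    = refl
  coeff-toℚ[t] (c ∷ cs) (suc k) = coeff-toℚ[t] cs k

  Deg-toℚ[t] : ∀ g s → HasDegree g s → Deg (toℚ[t] g) s
  Deg-toℚ[t] g s (lc≢0 , above) =
    (λ e → lc≢0 (ι-injective (trans (sym (coeff-toℚ[t] g s)) e))) ,
    λ k s<k → trans (coeff-toℚ[t] g k) (cong ι (above k s<k))

  eval-constant : ∀ h t → Deg h 0 → evalP h t ≡ coeffℚ h 0
  eval-constant []       t (h₀≢0 , _)     = ⊥-elim (h₀≢0 refl)
  eval-constant (c ∷ cs) t (_ , above) =
    trans (cong (λ w → c + t * w) (eval-zero cs t (λ k → above (suc k) (ℕ.s≤s ℕ.z≤n))))
          (trans (cong (_+_ c) (ℚP.*-zeroʳ t)) (ℚP.+-identityʳ c))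

  RationalBezout : List ℤ → List ℤ → Set
  RationalBezout f g = ∃[ U ] ∃[ V ] ∃[ c ] ((c ≢ 0ℚ) × (∀ t → evalP U t * eval f t + evalP V t * eval g t ≡ c))

  rationalBezout : ∀ f g s → HasDegree g s → CoprimeInℚ[t] f g → RationalBezout f g
  rationalBezout f g s deg-g coprime = constant-gcd (Euclid.euclid F G (suc s) F G s (ℕP.n<1+n s) (Deg-toℚ[t] g s deg-g)
                                        (λ _ h∣F h∣G → h∣F , h∣G) combF combG)
    where
    F = toℚ[t] f
    G = toℚ[t] g
    combF : Euclid.Combination F G F
    combF = 1ℚ ∷ [] , [] , λ t →
      solve 3 (λ t a b → (con 1ℚ :+ t :* con 0ℚ) :* a :+ con 0ℚ :* b := a) refl t (evalP F t) (evalP G t)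
    combG : Euclid.Combination F G G
    combG = [] , 1ℚ ∷ [] , λ t →
      solve 3 (λ t a b → con 0ℚ :* a :+ (con 1ℚ :+ t :* con 0ℚ) :* b := b) refl t (evalP F t) (evalP G t)
    toDivisibility : ∀ {h X} → Divides h X → h ∣ℚ[t] X
    toDivisibility {h} (p , hp≈X) = p , λ k → trans (sym (coeff-mul h p k)) (at hp≈X k)
    constant-gcd : Euclid.GcdCertificate F G → RationalBezout f g
    constant-gcd (h , zero , deg-h , _ , _ , U , V , comb) = U , V , coeffℚ h 0 , proj₁ deg-h , λ t →
      trans (cong₂ (λ a b → evalP U t * a + evalP V t * b) (eval-toℚ[t] f t) (eval-toℚ[t] g t))
            (trans (comb t) (eval-constant h t deg-h))
    constant-gcd (h , suc d , deg-h , h∣F , h∣G , _) =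
      ⊥-elim (coprime h (suc d , ℕ.s≤s ℕ.z≤n , proj₁ deg-h) (toDivisibility h∣F) (toDivisibility h∣G))

  eval-scaleℤ : ∀ D cs t → eval (map (D ℤ.*_) cs) t ≡ ι D * eval cs t
  eval-scaleℤ D []       t = sym (ℚP.*-zeroʳ (ι D))
  eval-scaleℤ D (c ∷ cs) t = trans (cong₂ (λ x y → x + t * y) (ι-* D c) (eval-scaleℤ D cs t))
    (solve 4 (λ d c t e → d :* c :+ t :* (d :* e) := d :* (c :+ t :* e)) refl (ι D) (ι c) t (eval cs t))

  ↧≢0 : ∀ q → ℚ.↧ q ≢ + 0
  ↧≢0 (ℚ.mkℚ _ _ _) ()

  IntegerMultiple : Poly → Set
  IntegerMultiple L = ∃[ L′ ] ∃[ D ] ((D ≢ + 0) × (∀ t → eval L′ t ≡ ι D * evalP L t))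

  clearDenominators : (L : Poly) → IntegerMultiple L
  clearDenominators []       = [] , + 1 , (λ ()) , λ t → sym (ℚP.*-zeroʳ 1ℚ)
  clearDenominators (q ∷ qs) with clearDenominators qs
  ... | L′ , D , D≢0 , eq = ℚ.↥ q ℤ.* D ∷ map (ℚ.↧ q ℤ.*_) L′ , ℚ.↧ q ℤ.* D , ↧qD≢0 , λ t → begin
      ι (ℚ.↥ q ℤ.* D) + t * eval (map (ℚ.↧ q ℤ.*_) L′) t
    ≡⟨ cong₂ (λ x y → x + t * y) (trans (ι-* (ℚ.↥ q) D) (cong (_* ι D) (ι-numerator q)))
                                 (trans (eval-scaleℤ (ℚ.↧ q) L′ t) (cong (ι (ℚ.↧ q) *_) (eq t))) ⟩
      ι (ℚ.↧ q) * q * ι D + t * (ι (ℚ.↧ q) * (ι D * evalP qs t))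
    ≡⟨ solve 5 (λ n q d t e → n :* q :* d :+ t :* (n :* (d :* e)) := (n :* d) :* (q :+ t :* e)) refl
         (ι (ℚ.↧ q)) q (ι D) t (evalP qs t) ⟩
      (ι (ℚ.↧ q) * ι D) * (q + t * evalP qs t)
    ≡⟨ cong (_* (q + t * evalP qs t)) (sym (ι-* (ℚ.↧ q) D)) ⟩
      ι (ℚ.↧ q ℤ.* D) * (q + t * evalP qs t)
    ∎
    where
    open ≡-Reasoning
    ↧qD≢0 : ℚ.↧ q ℤ.* D ≢ + 0
    ↧qD≢0 e = [ ↧≢0 q , D≢0 ]′ (ℤP.i*j≡0⇒i≡0∨j≡0 (ℚ.↧ q) e)

  IntegerBezout : List ℤ → List ℤ → Set
  IntegerBezout f g = ∃[ U ] ∃[ V ] ∃[ c ] ((c ≢ 0ℚ) × (∀ t → eval U t * eval f t + eval V t * eval g t ≡ c))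

  integerBezout : ∀ f g s → HasDegree g s → CoprimeInℚ[t] f g → IntegerBezout f g
  integerBezout f g s deg-g coprime = scale (rationalBezout f g s deg-g coprime)
    where
    scale : RationalBezout f g → IntegerBezout f g
    scale (U , V , c , c≢0 , comb) = scaled (clearDenominators U) (clearDenominators V)
      where
      scaled : IntegerMultiple U → IntegerMultiple V → IntegerBezout f g
      scaled (U′ , Du , Du≢0 , eu) (V′ , Dv , Dv≢0 , ev) =
        map (Dv ℤ.*_) U′ , map (Du ℤ.*_) V′ , ι (Dv ℤ.* Du) * c , *-≢0 (ι-≢0 DvDu≢0) c≢0 , λ t → begin
          eval (map (Dv ℤ.*_) U′) t * eval f t + eval (map (Du ℤ.*_) V′) t * eval g t
        ≡⟨ cong₂ (λ x y → x * eval f t + y * eval g t) (trans (eval-scaleℤ Dv U′ t) (cong (ι Dv *_) (eu t)))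
                                                         (trans (eval-scaleℤ Du V′ t) (cong (ι Du *_) (ev t))) ⟩
          ι Dv * (ι Du * evalP U t) * eval f t + ι Du * (ι Dv * evalP V t) * eval g t
        ≡⟨ factor (ι Dv) (ι Du) (evalP U t) (evalP V t) (eval f t) (eval g t) ⟩
          ι Dv * ι Du * (evalP U t * eval f t + evalP V t * eval g t)
        ≡⟨ cong₂ _*_ (sym (ι-* Dv Du)) (comb t) ⟩
          ι (Dv ℤ.* Du) * c
        ∎
        where
        open ≡-Reasoning
        factor : ∀ a b u v x y → a * (b * u) * x + b * (a * v) * y ≡ a * b * (u * x + v * y)
        factor = solve 6 (λ a b u v x y → a :* (b :* u) :* x :+ b :* (a :* v) :* y := a :* b :* (u :* x :+ v :* y)) refl
        DvDu≢0 : Dv ℤ.* Du ≢ + 0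
        DvDu≢0 e = [ Dv≢0 , Du≢0 ]′ (ℤP.i*j≡0⇒i≡0∨j≡0 Dv e)

open Bezout

-- Weighted homogenisation: for h = Σ cₖ tᵏ, integers a, b and a weight w,
--   homogenize h a b m w = Σ cₖ aᵏ b^(w - m k)   (truncated subtraction),
-- computed by Horner's rule.  When every nonzero cₖ has m k ≤ w this is the
-- integer b^w h(a/b^m); if moreover w = m·deg h it is ≡ lc(h)·a^deg h mod b.
module Homogenization where
  open ℚSolver.+-*-Solver

  homogenize : List ℤ → ℤ → ℤ → ℕ → ℕ → ℤ
  homogenize []       a b m w = + 0
  homogenize (c ∷ cs) a b m w = c ℤ.* b ℤ.^ w ℤ.+ a ℤ.* homogenize cs a b m (w ∸ m)

  homogenize-zero : ∀ cs a b m w → (∀ k → coeffℤ cs k ≡ + 0) → homogenize cs a b m w ≡ + 0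
  homogenize-zero []       a b m w z = refl
  homogenize-zero (c ∷ cs) a b m w z =
    trans (cong₂ (λ x y → x ℤ.* b ℤ.^ w ℤ.+ a ℤ.* y) (z 0) (homogenize-zero cs a b m (w ∸ m) (λ k → z (suc k))))
          (cong (ℤ._+_ (+ 0)) (ℤP.*-zeroʳ a))

  eval-zeroℤ : ∀ cs t → (∀ k → coeffℤ cs k ≡ + 0) → eval cs t ≡ 0ℚ
  eval-zeroℤ cs t z = trans (eval-toℚ[t] cs t)
    (eval-zero (toℚ[t] cs) t (λ k → trans (coeff-toℚ[t] cs k) (cong ι (z k))))

  coeffℤ-beyond : ∀ cs k → length cs ℕ.≤ k → coeffℤ cs k ≡ + 0
  coeffℤ-beyond []       k       _          = refl
  coeffℤ-beyond (c ∷ cs) (suc k) (ℕ.s≤s le) = coeffℤ-beyond cs k le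

  module _ (a b : ℤ) (m : ℕ) (b≢0 : ι b ≢ 0ℚ) where
    private
      β = ι b
      t = ι a divℚ (β ^ℚ m)
      βᵐt≡a : β ^ℚ m * t ≡ ι a
      βᵐt≡a = divℚ-cancel (ι a) (β ^ℚ m) (^ℚ-≢0 m b≢0)

    ι-homogenize : ∀ cs w → (∀ k → w ℕ.< m ℕ.* k → coeffℤ cs k ≡ + 0) →
                   ι (homogenize cs a b m w) ≡ β ^ℚ w * eval cs t
    ι-homogenize []       w z = sym (ℚP.*-zeroʳ (β ^ℚ w))
    ι-homogenize (c ∷ cs) w z with m ℕ.≤? w
    ... | yes m≤w = begin
        ι (c ℤ.* b ℤ.^ w ℤ.+ a ℤ.* homogenize cs a b m (w ∸ m))
      ≡⟨ trans (ι-+ (c ℤ.* b ℤ.^ w) _) (cong₂ _+_ (trans (ι-* c (b ℤ.^ w)) (cong (ι c *_) (ι-^ b w)))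
                                    (trans (ι-* a _) (cong (ι a *_) (ι-homogenize cs (w ∸ m) z′)))) ⟩
        ι c * β ^ℚ w + ι a * (β ^ℚ (w ∸ m) * eval cs t)
      ≡⟨ cong₂ (λ x y → ι c * x + y * (β ^ℚ (w ∸ m) * eval cs t)) βʷ-split (sym βᵐt≡a) ⟩
        ι c * (β ^ℚ m * β ^ℚ (w ∸ m)) + (β ^ℚ m * t) * (β ^ℚ (w ∸ m) * eval cs t)
      ≡⟨ solve 5 (λ c x y t e → c :* (x :* y) :+ (x :* t) :* (y :* e) := (x :* y) :* (c :+ t :* e)) refl
           (ι c) (β ^ℚ m) (β ^ℚ (w ∸ m)) t (eval cs t) ⟩
        (β ^ℚ m * β ^ℚ (w ∸ m)) * (ι c + t * eval cs t)
      ≡⟨ cong (_* (ι c + t * eval cs t)) (sym βʷ-split) ⟩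
        β ^ℚ w * (ι c + t * eval cs t)
      ∎
      where
      open ≡-Reasoning
      βʷ-split : β ^ℚ w ≡ β ^ℚ m * β ^ℚ (w ∸ m)
      βʷ-split = trans (cong (β ^ℚ_) (sym (ℕP.m+[n∸m]≡n m≤w))) (^ℚ-+ β m (w ∸ m))
      z′ : ∀ k → w ∸ m ℕ.< m ℕ.* k → coeffℤ cs k ≡ + 0
      z′ k lt = z (suc k) (subst₂ ℕ._<_ (ℕP.m+[n∸m]≡n m≤w) (sym (ℕP.*-suc m k)) (ℕP.+-monoʳ-< m lt))
    ... | no m≰w = begin
        ι (c ℤ.* b ℤ.^ w ℤ.+ a ℤ.* homogenize cs a b m (w ∸ m))
      ≡⟨ cong (λ x → ι (c ℤ.* b ℤ.^ w ℤ.+ a ℤ.* x)) (homogenize-zero cs a b m (w ∸ m) tail≡0) ⟩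
        ι (c ℤ.* b ℤ.^ w ℤ.+ a ℤ.* + 0)
      ≡⟨ trans (ι-+ (c ℤ.* b ℤ.^ w) _) (cong₂ _+_ (trans (ι-* c (b ℤ.^ w)) (cong (ι c *_) (ι-^ b w))) (ι-* a (+ 0))) ⟩
        ι c * β ^ℚ w + ι a * 0ℚ
      ≡⟨ solve 4 (λ c x a t → c :* x :+ a :* con 0ℚ := x :* (c :+ t :* con 0ℚ)) refl (ι c) (β ^ℚ w) (ι a) t ⟩
        β ^ℚ w * (ι c + t * 0ℚ)
      ≡⟨ cong (λ x → β ^ℚ w * (ι c + t * x)) (sym (eval-zeroℤ cs t tail≡0)) ⟩
        β ^ℚ w * (ι c + t * eval cs t)
      ∎
      where
      open ≡-Reasoning
      tail≡0 : ∀ k → coeffℤ cs k ≡ + 0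
      tail≡0 k = z (suc k) (ℕP.<-≤-trans (ℕP.≰⇒> m≰w) (subst (m ℕ.≤_) (sym (ℕP.*-suc m k)) (ℕP.m≤m+n m (m ℕ.* k))))

  homogenize-mod-b : ∀ cs a b m′ r → (∀ k → r ℕ.< k → coeffℤ cs k ≡ + 0) →
    ∃[ W ] (homogenize cs a b (suc m′) (suc m′ ℕ.* r) ≡ coeffℤ cs r ℤ.* a ℤ.^ r ℤ.+ b ℤ.* W)
  homogenize-mod-b []       a b m′ r z = + 0 , sym (cong₂ ℤ._+_ (ℤP.*-zeroˡ (a ℤ.^ r)) (ℤP.*-zeroʳ b))
  homogenize-mod-b (c ∷ cs) a b m′ zero z = + 0 , (begin
      homogenize (c ∷ cs) a b (suc m′) (suc m′ ℕ.* 0)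
    ≡⟨ cong (homogenize (c ∷ cs) a b (suc m′)) (ℕP.*-zeroʳ (suc m′)) ⟩
      c ℤ.* + 1 ℤ.+ a ℤ.* homogenize cs a b (suc m′) 0
    ≡⟨ cong (λ x → c ℤ.* + 1 ℤ.+ a ℤ.* x) (homogenize-zero cs a b (suc m′) 0 (λ k → z (suc k) (ℕ.s≤s ℕ.z≤n))) ⟩
      c ℤ.* + 1 ℤ.+ a ℤ.* + 0
    ≡⟨ cong (ℤ._+_ (c ℤ.* + 1)) (trans (ℤP.*-zeroʳ a) (sym (ℤP.*-zeroʳ b))) ⟩
      c ℤ.* + 1 ℤ.+ b ℤ.* + 0
    ∎)
    where open ≡-Reasoning
  homogenize-mod-b (c ∷ cs) a b m′ (suc r) z with homogenize-mod-b cs a b m′ r (λ k lt → z (suc k) (ℕ.s≤s lt))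
  ... | W′ , eq = c ℤ.* b ℤ.^ (m′ ℕ.+ m ℕ.* r) ℤ.+ a ℤ.* W′ , (begin
      homogenize (c ∷ cs) a b m (m ℕ.* suc r)
    ≡⟨ cong (homogenize (c ∷ cs) a b m) (ℕP.*-suc m r) ⟩
      c ℤ.* b ℤ.^ (m ℕ.+ m ℕ.* r) ℤ.+ a ℤ.* homogenize cs a b m ((m ℕ.+ m ℕ.* r) ∸ m)
    ≡⟨ cong (λ x → c ℤ.* b ℤ.^ (m ℕ.+ m ℕ.* r) ℤ.+ a ℤ.* homogenize cs a b m x) (ℕP.m+n∸m≡n m (m ℕ.* r)) ⟩
      c ℤ.* (b ℤ.* b ℤ.^ (m′ ℕ.+ m ℕ.* r)) ℤ.+ a ℤ.* homogenize cs a b m (m ℕ.* r)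
    ≡⟨ cong (λ x → c ℤ.* (b ℤ.* b ℤ.^ (m′ ℕ.+ m ℕ.* r)) ℤ.+ a ℤ.* x) eq ⟩
      c ℤ.* (b ℤ.* b ℤ.^ (m′ ℕ.+ m ℕ.* r)) ℤ.+ a ℤ.* (coeffℤ cs r ℤ.* a ℤ.^ r ℤ.+ b ℤ.* W′)
    ≡⟨ regroup c b (b ℤ.^ (m′ ℕ.+ m ℕ.* r)) a (coeffℤ cs r) (a ℤ.^ r) W′ ⟩
      coeffℤ cs r ℤ.* (a ℤ.* a ℤ.^ r) ℤ.+ b ℤ.* (c ℤ.* b ℤ.^ (m′ ℕ.+ m ℕ.* r) ℤ.+ a ℤ.* W′)
    ∎)
    where
    open ≡-Reasoning
    m = suc m′
    regroup : ∀ c b X a e W V → c ℤ.* (b ℤ.* X) ℤ.+ a ℤ.* (e ℤ.* W ℤ.+ b ℤ.* V) ≡ e ℤ.* (a ℤ.* W) ℤ.+ b ℤ.* (c ℤ.* X ℤ.+ a ℤ.* V)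
    regroup = solve-∀

open Homogenization

module Arithmetic where

  ∣^∣ : ∀ i n → ∣ i ℤ.^ n ∣ ≡ ∣ i ∣ ℕ.^ n
  ∣^∣ i zero    = refl
  ∣^∣ i (suc n) = trans (ℤP.abs-* i (i ℤ.^ n)) (cong (∣ i ∣ ℕ.*_) (∣^∣ i n))

  *-^ : ∀ x y k → (x ℕ.* y) ℕ.^ k ≡ x ℕ.^ k ℕ.* y ℕ.^ k
  *-^ x y zero    = refl
  *-^ x y (suc k) = trans (cong (x ℕ.* y ℕ.*_) (*-^ x y k)) (interchange ℕP.*-commutativeSemigroup x y (x ℕ.^ k) (y ℕ.^ k))

  ^-mono-∣ : ∀ L {x y} → x ∣ y → x ℕ.^ L ∣ y ℕ.^ L
  ^-mono-∣ zero    _   = ℕD.∣-refl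
  ^-mono-∣ (suc L) x∣y = ℕD.*-pres-∣ x∣y (^-mono-∣ L x∣y)

  gcd-*-∣ : ∀ u v y → gcd (u ℕ.* v) y ∣ gcd u y ℕ.* gcd v y
  gcd-*-∣ u v y = subst (g ∣_) gcd-factor (gcd-greatest g∣u·G g∣y·G)
    where
    g = gcd (u ℕ.* v) y
    G = gcd v y
    g∣y = gcd[m,n]∣n (u ℕ.* v) y
    g∣u·G : g ∣ u ℕ.* G
    g∣u·G = subst (g ∣_) (sym (c*gcd[m,n]≡gcd[cm,cn] u v y))
                  (gcd-greatest (gcd[m,n]∣m (u ℕ.* v) y) (ℕD.∣n⇒∣m*n u g∣y))
    g∣y·G : g ∣ y ℕ.* G
    g∣y·G = subst (g ∣_) (sym (c*gcd[m,n]≡gcd[cm,cn] y v y))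
                  (gcd-greatest (subst (g ∣_) (ℕP.*-comm v y) (ℕD.∣n⇒∣m*n v g∣y)) (ℕD.∣n⇒∣m*n y g∣y))
    gcd-factor : gcd (u ℕ.* G) (y ℕ.* G) ≡ gcd u y ℕ.* G
    gcd-factor = trans (cong₂ gcd (ℕP.*-comm u G) (ℕP.*-comm y G))
                       (trans (sym (c*gcd[m,n]≡gcd[cm,cn] G u y)) (ℕP.*-comm G (gcd u y)))

  gcd-^-∣ : ∀ x y L → gcd (x ℕ.^ L) y ∣ gcd x y ℕ.^ L
  gcd-^-∣ x y zero    = subst (_∣ 1) (sym (gcd-zeroˡ y)) ℕD.∣-refl
  gcd-^-∣ x y (suc L) = ℕD.∣-trans (gcd-*-∣ x (x ℕ.^ L) y) (ℕD.*-monoʳ-∣ (gcd x y) (gcd-^-∣ x y L))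

  coprime-* : ∀ {x y z} → Coprime x y → Coprime x z → Coprime x (y ℕ.* z)
  coprime-* x⊥y x⊥z (d∣x , d∣yz) = x⊥z (d∣x , coprime-divisor (λ (e∣d , e∣y) → x⊥y (ℕD.∣-trans e∣d d∣x , e∣y)) d∣yz)

  coprime-^ : ∀ {x y} j → Coprime x y → Coprime x (y ℕ.^ j)
  coprime-^ zero    _   (_ , d∣1) = ℕD.∣1⇒≡1 d∣1
  coprime-^ (suc j) x⊥y = coprime-* x⊥y (coprime-^ j x⊥y)

  ^-mod : ∀ u b W k → ∃[ Z ] ((u ℤ.+ b ℤ.* W) ℤ.^ k ≡ u ℤ.^ k ℤ.+ b ℤ.* Z)
  ^-mod u b W zero    = + 0 , sym (cong (ℤ._+_ (+ 1)) (ℤP.*-zeroʳ b))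
  ^-mod u b W (suc k) with ^-mod u b W k
  ... | Z , eq = W ℤ.* (u ℤ.^ k ℤ.+ b ℤ.* Z) ℤ.+ u ℤ.* Z ,
    trans (cong ((u ℤ.+ b ℤ.* W) ℤ.*_) eq) (expand u b W Z (u ℤ.^ k))
    where
    expand : ∀ u b W Z uᵏ → (u ℤ.+ b ℤ.* W) ℤ.* (uᵏ ℤ.+ b ℤ.* Z) ≡ u ℤ.* uᵏ ℤ.+ b ℤ.* (W ℤ.* (uᵏ ℤ.+ b ℤ.* Z) ℤ.+ u ℤ.* Z)
    expand = solve-∀

  -- If a ⊥ b, D ∣ C·|b|ᴸ and D ∣ |e aʳ + bW|ᵏ, then D ∣ C·(|e|ᵏ)ᴸ: the part of D
  -- dividing a power of b can only come from e, since aʳ is a unit mod b.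
  coprime-part : ∀ (a b e W : ℤ) (C D r k L : ℕ) → Coprime ∣ a ∣ ∣ b ∣ →
    D ∣ C ℕ.* ∣ b ∣ ℕ.^ L → D ∣ ∣ e ℤ.* a ℤ.^ r ℤ.+ b ℤ.* W ∣ ℕ.^ k → D ∣ C ℕ.* (∣ e ∣ ℕ.^ k) ℕ.^ L
  coprime-part a b e W C D r k L a⊥b D∣Cbᴸ D∣Fᵏ =
    ℕD.∣-trans D∣C·g (ℕD.*-monoʳ-∣ C (ℕD.∣-trans (gcd-^-∣ β Fᵏ L) (^-mono-∣ L g∣eᵏ)))
    where
    β  = ∣ b ∣
    F  = e ℤ.* a ℤ.^ r ℤ.+ b ℤ.* W
    Fᵏ = ∣ F ∣ ℕ.^ k
    g  = gcd β Fᵏ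
    D∣C·g : D ∣ C ℕ.* gcd (β ℕ.^ L) Fᵏ
    D∣C·g = subst (D ∣_) (sym (c*gcd[m,n]≡gcd[cm,cn] C (β ℕ.^ L) Fᵏ)) (gcd-greatest D∣Cbᴸ (ℕD.∣n⇒∣m*n C D∣Fᵏ))
    Z  = proj₁ (^-mod (e ℤ.* a ℤ.^ r) b W k)
    -- g divides b and Fᵏ ≡ (e aʳ)ᵏ (mod b), hence g ∣ (e aʳ)ᵏ = |a|^(rk) |e|ᵏ
    g∣eᵏaʳᵏ : (+ g) ℤS.∣ (e ℤ.* a ℤ.^ r) ℤ.^ k
    g∣eᵏaʳᵏ = ℤS.∣m+n∣n⇒∣m (subst ((+ g) ℤS.∣_) (proj₂ (^-mod (e ℤ.* a ℤ.^ r) b W k))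
                                   (ℤS.∣ᵤ⇒∣ (subst (g ∣_) (sym (∣^∣ F k)) (gcd[m,n]∣n β Fᵏ))))
                              (ℤS.∣m⇒∣m*n {m = b} Z (ℤS.∣ᵤ⇒∣ (gcd[m,n]∣m β Fᵏ)))
    ∣eᵏaʳᵏ∣ : ∣ (e ℤ.* a ℤ.^ r) ℤ.^ k ∣ ≡ ∣ a ∣ ℕ.^ (r ℕ.* k) ℕ.* ∣ e ∣ ℕ.^ k
    ∣eᵏaʳᵏ∣ = begin
      ∣ (e ℤ.* a ℤ.^ r) ℤ.^ k ∣              ≡⟨ ∣^∣ (e ℤ.* a ℤ.^ r) k ⟩
      ∣ e ℤ.* a ℤ.^ r ∣ ℕ.^ k                ≡⟨ cong (ℕ._^ k) (trans (ℤP.abs-* e (a ℤ.^ r)) (cong (∣ e ∣ ℕ.*_) (∣^∣ a r))) ⟩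
      (∣ e ∣ ℕ.* ∣ a ∣ ℕ.^ r) ℕ.^ k          ≡⟨ *-^ ∣ e ∣ (∣ a ∣ ℕ.^ r) k ⟩
      ∣ e ∣ ℕ.^ k ℕ.* (∣ a ∣ ℕ.^ r) ℕ.^ k    ≡⟨ ℕP.*-comm (∣ e ∣ ℕ.^ k) _ ⟩
      (∣ a ∣ ℕ.^ r) ℕ.^ k ℕ.* ∣ e ∣ ℕ.^ k    ≡⟨ cong (ℕ._* ∣ e ∣ ℕ.^ k) (ℕP.^-*-assoc ∣ a ∣ r k) ⟩
      ∣ a ∣ ℕ.^ (r ℕ.* k) ℕ.* ∣ e ∣ ℕ.^ k    ∎
      where open ≡-Reasoning
    g∣eᵏ : g ∣ ∣ e ∣ ℕ.^ k
    g∣eᵏ = coprime-divisor (coprime-^ (r ℕ.* k) (λ (c∣g , c∣a) → a⊥b (c∣a , ℕD.∣-trans c∣g (gcd[m,n]∣m β Fᵏ))))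
                           (subst (g ∣_) ∣eᵏaʳᵏ∣ (ℤS.∣⇒∣ᵤ g∣eᵏaʳᵏ))

  ^12-∣⇒≤ : ∀ d N → 1 ℕ.≤ d → N ≢ 0 → d ℕ.^ 12 ∣ N → d ℕ.≤ N
  ^12-∣⇒≤ d N 1≤d N≢0 d¹²∣N =
    ℕP.≤-trans (ℕP.m≤m*n d (d ℕ.^ 11) {{ℕ.≢-nonZero d¹¹≢0}}) (ℕD.∣⇒≤ {{ℕ.≢-nonZero N≢0}} d¹²∣N)
    where
    d¹¹≢0 : d ℕ.^ 11 ≢ 0
    d¹¹≢0 e = ℕP.<⇒≢ 1≤d (sym (ℕP.m^n≡0⇒m≡0 d 11 e))

open Arithmetic

common-divisor-⁴ : ∀ {D} A B α β → D ℤS.∣ A ℤ.^ 3 → D ℤS.∣ B ℤ.^ 2 → D ℤS.∣ (A ℤ.* α ℤ.+ B ℤ.* β) ℤ.^ 4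
common-divisor-⁴ A B α β D∣A³ D∣B² = subst (_ ℤS.∣_) (sym quartic)
  (ℤS.∣m∣n⇒∣m+n (ℤS.∣m⇒∣m*n _ D∣A³) (ℤS.∣m⇒∣m*n _ D∣B²))
  where
  open ℤSolver.+-*-Solver
  x = A ℤ.* α
  y = B ℤ.* β
  quartic : (x ℤ.+ y) ℤ.^ 4 ≡
    A ℤ.^ 3 ℤ.* (α ℤ.^ 3 ℤ.* (x ℤ.+ + 4 ℤ.* y)) ℤ.+ B ℤ.^ 2 ℤ.* (β ℤ.^ 2 ℤ.* (+ 6 ℤ.* x ℤ.* x ℤ.+ + 4 ℤ.* x ℤ.* y ℤ.+ y ℤ.* y))
  quartic = solve 4 (λ A α B β → (A :* α :+ B :* β) :^ 4 :=
    A :^ 3 :* (α :^ 3 :* (A :* α :+ con (+ 4) :* (B :* β))) :+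
    B :^ 2 :* (β :^ 2 :* (con (+ 6) :* (A :* α) :* (A :* α) :+ con (+ 4) :* (A :* α) :* (B :* β) :+ (B :* β) :* (B :* β)))) refl A α B β

-- Homogenising it at a point
-- (a, b) gives an integer relation  A·α + B·β = ↥c · b^E  (α, β integers),
-- so every d with d¹² ∣ A³, B² satisfies d¹² ∣ |↥c|⁴ · |b|^(4E).
module ScalingBound (f g : List ℤ) (n m′ : ℕ) (U V : List ℤ) (c : ℚ)
                    (bezout : ∀ t → eval U t * eval f t + eval V t * eval g t ≡ c) where
  m  = suc m′
  Ku = length U
  Kv = length V
  E  = m ℕ.* Ku ℕ.+ 4 ℕ.* n ℕ.+ (6 ℕ.* n ℕ.+ m ℕ.* Kv)

  C : ℕ
  C = ∣ ℚ.↥ c ∣ ℕ.^ 4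

  L : ℕ
  L = 4 ℕ.* E

  vanishes-above-length : ∀ cs k → m ℕ.* length cs ℕ.< m ℕ.* k → coeffℤ cs k ≡ + 0
  vanishes-above-length cs k lt = coeffℤ-beyond cs k (ℕP.<⇒≤ (ℕP.*-cancelˡ-< m (length cs) k lt))

  module _ (a b A B : ℤ) (b≢0 : ι b ≢ 0ℚ) (eA : ι A ≡ Aval f n m a b) (eB : ι B ≡ Bval g n m a b) where
    private
      β = ι b
      t = ι a divℚ (β ^ℚ m)
      P = homogenize U a b m (m ℕ.* Ku)
      Q = homogenize V a b m (m ℕ.* Kv)
      eP : ι P ≡ β ^ℚ (m ℕ.* Ku) * eval U t
      eP = ι-homogenize a b m b≢0 U (m ℕ.* Ku) (vanishes-above-length U)
      eQ : ι Q ≡ β ^ℚ (m ℕ.* Kv) * eval V t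
      eQ = ι-homogenize a b m b≢0 V (m ℕ.* Kv) (vanishes-above-length V)
      α₀ = P ℤ.* b ℤ.^ (6 ℕ.* n ℕ.+ m ℕ.* Kv)
      β₀ = Q ℤ.* b ℤ.^ (4 ℕ.* n ℕ.+ m ℕ.* Ku)

      -- U f + V g = c at t = a/bᵐ, multiplied by b^E
      homogenized-bezout : ι A * ι α₀ + ι B * ι β₀ ≡ β ^ℚ E * c
      homogenized-bezout = begin
          ι A * ι α₀ + ι B * ι β₀
        ≡⟨ cong₂ _+_ (cong₂ _*_ eA (trans (ι-* P _) (cong₂ _*_ eP (trans (ι-^ b (6 ℕ.* n ℕ.+ m ℕ.* Kv)) (^ℚ-+ β (6 ℕ.* n) (m ℕ.* Kv))))))
                     (cong₂ _*_ eB (trans (ι-* Q _) (cong₂ _*_ eQ (trans (ι-^ b (4 ℕ.* n ℕ.+ m ℕ.* Ku)) (^ℚ-+ β (4 ℕ.* n) (m ℕ.* Ku)))))) ⟩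
          (p₂ * eval f t) * ((p₁ * eval U t) * (p₃ * p₄)) + (p₃ * eval g t) * ((p₄ * eval V t) * (p₂ * p₁))
        ≡⟨ factor p₁ p₂ p₃ p₄ (eval U t) (eval V t) (eval f t) (eval g t) ⟩
          (p₁ * p₂) * (p₃ * p₄) * (eval U t * eval f t + eval V t * eval g t)
        ≡⟨ cong₂ _*_ (trans (cong₂ _*_ (sym (^ℚ-+ β (m ℕ.* Ku) (4 ℕ.* n))) (sym (^ℚ-+ β (6 ℕ.* n) (m ℕ.* Kv))))
                            (sym (^ℚ-+ β (m ℕ.* Ku ℕ.+ 4 ℕ.* n) (6 ℕ.* n ℕ.+ m ℕ.* Kv))))
                     (bezout t) ⟩
          β ^ℚ E * c
        ∎
        where
        open ≡-Reasoning
        open ℚSolver.+-*-Solver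
        p₁ = β ^ℚ (m ℕ.* Ku)
        p₂ = β ^ℚ (4 ℕ.* n)
        p₃ = β ^ℚ (6 ℕ.* n)
        p₄ = β ^ℚ (m ℕ.* Kv)
        factor : ∀ p₁ p₂ p₃ p₄ u v x y →
          (p₂ * x) * ((p₁ * u) * (p₃ * p₄)) + (p₃ * y) * ((p₄ * v) * (p₂ * p₁)) ≡ (p₁ * p₂) * (p₃ * p₄) * (u * x + v * y)
        factor = solve 8 (λ p₁ p₂ p₃ p₄ u v x y →
          (p₂ :* x) :* ((p₁ :* u) :* (p₃ :* p₄)) :+ (p₃ :* y) :* ((p₄ :* v) :* (p₂ :* p₁))
            := (p₁ :* p₂) :* (p₃ :* p₄) :* (u :* x :+ v :* y)) refl

    integer-relation : A ℤ.* (ℚ.↧ c ℤ.* α₀) ℤ.+ B ℤ.* (ℚ.↧ c ℤ.* β₀) ≡ ℚ.↥ c ℤ.* b ℤ.^ E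
    integer-relation = ι-injective (begin
        ι (A ℤ.* (ℚ.↧ c ℤ.* α₀) ℤ.+ B ℤ.* (ℚ.↧ c ℤ.* β₀))
      ≡⟨ trans (ι-+ (A ℤ.* (ℚ.↧ c ℤ.* α₀)) _) (cong₂ _+_ (trans (ι-* A _) (cong (ι A *_) (ι-* (ℚ.↧ c) α₀)))
                                                          (trans (ι-* B _) (cong (ι B *_) (ι-* (ℚ.↧ c) β₀)))) ⟩
        ι A * (ι (ℚ.↧ c) * ι α₀) + ι B * (ι (ℚ.↧ c) * ι β₀)
      ≡⟨ factor (ι A) (ι B) (ι (ℚ.↧ c)) (ι α₀) (ι β₀) ⟩
        ι (ℚ.↧ c) * (ι A * ι α₀ + ι B * ι β₀)
      ≡⟨ cong (ι (ℚ.↧ c) *_) homogenized-bezout ⟩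
        ι (ℚ.↧ c) * (β ^ℚ E * c)
      ≡⟨ rearrange (ι (ℚ.↧ c)) (β ^ℚ E) c ⟩
        ι (ℚ.↧ c) * c * β ^ℚ E
      ≡⟨ cong₂ _*_ (sym (ι-numerator c)) (sym (ι-^ b E)) ⟩
        ι (ℚ.↥ c) * ι (b ℤ.^ E)
      ≡⟨ sym (ι-* (ℚ.↥ c) (b ℤ.^ E)) ⟩
        ι (ℚ.↥ c ℤ.* b ℤ.^ E)
      ∎)
      where
      open ≡-Reasoning
      open ℚSolver.+-*-Solver
      factor : ∀ a b d x y → a * (d * x) + b * (d * y) ≡ d * (a * x + b * y)
      factor = solve 5 (λ a b d x y → a :* (d :* x) :+ b :* (d :* y) := d :* (a :* x :+ b :* y)) refl
      rearrange : ∀ d p c → d * (p * c) ≡ d * c * p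
      rearrange = solve 3 (λ d p c → d :* (p :* c) := d :* c :* p) refl

    scaling-bound : ∀ d → (+ d) ℤ.^ 12 ℤS.∣ A ℤ.^ 3 → (+ d) ℤ.^ 12 ℤS.∣ B ℤ.^ 2 → d ℕ.^ 12 ∣ C ℕ.* ∣ b ∣ ℕ.^ L
    scaling-bound d d¹²∣A³ d¹²∣B² = subst₂ _∣_ (∣^∣ (+ d) 12) absolute (ℤS.∣⇒∣ᵤ d¹²∣cbᴱ⁴)
      where
      d¹²∣cbᴱ⁴ : (+ d) ℤ.^ 12 ℤS.∣ (ℚ.↥ c ℤ.* b ℤ.^ E) ℤ.^ 4
      d¹²∣cbᴱ⁴ = subst (λ z → (+ d) ℤ.^ 12 ℤS.∣ z ℤ.^ 4) integer-relation
                       (common-divisor-⁴ A B (ℚ.↧ c ℤ.* α₀) (ℚ.↧ c ℤ.* β₀) d¹²∣A³ d¹²∣B²)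
      absolute : ∣ (ℚ.↥ c ℤ.* b ℤ.^ E) ℤ.^ 4 ∣ ≡ C ℕ.* ∣ b ∣ ℕ.^ L
      absolute = begin
          ∣ (ℚ.↥ c ℤ.* b ℤ.^ E) ℤ.^ 4 ∣
        ≡⟨ ∣^∣ (ℚ.↥ c ℤ.* b ℤ.^ E) 4 ⟩
          ∣ ℚ.↥ c ℤ.* b ℤ.^ E ∣ ℕ.^ 4
        ≡⟨ cong (ℕ._^ 4) (trans (ℤP.abs-* (ℚ.↥ c) (b ℤ.^ E)) (cong (∣ ℚ.↥ c ∣ ℕ.*_) (∣^∣ b E))) ⟩
          (∣ ℚ.↥ c ∣ ℕ.* ∣ b ∣ ℕ.^ E) ℕ.^ 4
        ≡⟨ *-^ ∣ ℚ.↥ c ∣ (∣ b ∣ ℕ.^ E) 4 ⟩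
          C ℕ.* (∣ b ∣ ℕ.^ E) ℕ.^ 4
        ≡⟨ cong (C ℕ.*_) (trans (ℕP.^-*-assoc ∣ b ∣ E 4) (cong (∣ b ∣ ℕ.^_) (ℕP.*-comm E 4))) ⟩
          C ℕ.* ∣ b ∣ ℕ.^ L
        ∎
        where open ≡-Reasoning

weight-equation : ∀ x c′ n m′ → (+ x) ℚ./ suc c′ ≡ (+ n) ℚ./ suc m′ → suc m′ ℕ.* x ≡ suc c′ ℕ.* n
weight-equation x c′ n m′ e =
  trans (ℕP.*-comm (suc m′) x) (trans (ℚP.normalize-injective-≃ x n (suc c′) (suc m′) e) (ℕP.*-comm n (suc c′)))

-- The maximum in max(r/4, s/6) = n/m is attained: m r = 4 n or m s = 6 n.
-- The polynomial attaining it is the one whose leading term survives mod b.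
tight-weight : ∀ r s n m′ → ((+ r) ℚ./ 4) ⊔ ((+ s) ℚ./ 6) ≡ (+ n) ℚ./ suc m′ →
               suc m′ ℕ.* r ≡ 4 ℕ.* n ⊎ suc m′ ℕ.* s ≡ 6 ℕ.* n
tight-weight r s n m′ max≡ with ℚP.⊔-sel ((+ r) ℚ./ 4) ((+ s) ℚ./ 6)
... | inj₁ max≡r/4 = inj₁ (weight-equation r 3 n m′ (trans (sym max≡r/4) max≡))
... | inj₂ max≡s/6 = inj₂ (weight-equation s 5 n m′ (trans (sym max≡s/6) max≡))

-- If Z = b^w h(a/b^m) for
-- coprime a, b, then Z ≡ lc(h)·aʳ (mod b), so any d with d¹² ∣ Zᵏ and
-- d¹² ∣ C·|b|ᴸ satisfies d¹² ∣ C·(|lc h|ᵏ)ᴸ, a bound independent of (a, b).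
leading-coefficient-bound : ∀ h r m′ w k C L a b Z d → HasDegree h r → suc m′ ℕ.* r ≡ w →
  ι b ≢ 0ℚ → Coprime ∣ a ∣ ∣ b ∣ → ι Z ≡ (ι b ^ℚ w) * eval h (ι a divℚ (ι b ^ℚ suc m′)) →
  (+ d) ℤ.^ 12 ℤS.∣ Z ℤ.^ k → d ℕ.^ 12 ∣ C ℕ.* ∣ b ∣ ℕ.^ L → d ℕ.^ 12 ∣ C ℕ.* (∣ coeffℤ h r ∣ ℕ.^ k) ℕ.^ L
leading-coefficient-bound h r m′ w k C L a b Z d deg-h@(_ , above) refl b≢0 a⊥b eZ d¹²∣Zᵏ d¹²∣Cbᴸ =
  coprime-part a b (coeffℤ h r) W C (d ℕ.^ 12) r k L a⊥b d¹²∣Cbᴸ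
    (subst (λ z → d ℕ.^ 12 ∣ ∣ z ∣ ℕ.^ k) Z≡lc·aʳ+bW (subst₂ _∣_ (∣^∣ (+ d) 12) (∣^∣ Z k) (ℤS.∣⇒∣ᵤ d¹²∣Zᵏ)))
  where
  m = suc m′
  vanish : ∀ j → m ℕ.* r ℕ.< m ℕ.* j → coeffℤ h j ≡ + 0
  vanish j lt = above j (ℕP.*-cancelˡ-< m r j lt)
  W = proj₁ (homogenize-mod-b h a b m′ r above)
  Z≡lc·aʳ+bW : Z ≡ coeffℤ h r ℤ.* a ℤ.^ r ℤ.+ b ℤ.* W
  Z≡lc·aʳ+bW = trans (ι-injective (trans eZ (sym (ι-homogenize a b m b≢0 h (m ℕ.* r) vanish))))
                     (proj₂ (homogenize-mod-b h a b m′ r above))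

unique-lookup : {A : Set} {xs : List A} → Unique xs → ∀ {i j} → i Fin.< j → lookup xs i ≢ lookup xs j
unique-lookup {xs = x ∷ xs} (x∉xs ∷ _) {zero}  {suc j} _           = All.lookup x∉xs (∈-lookup j)
unique-lookup {xs = x ∷ xs} (_ ∷ u)    {suc i} {suc j} (ℕ.s≤s i<j) = unique-lookup u i<j

labelled-pigeonhole : {A : Set} {P : A → Set} (N : ℕ) (label : ∀ x → P x → ℕ) →
  (∀ x (p : P x) → label x p ℕ.< N) →
  (∀ x y (p : P x) (q : P y) → label x p ≡ label y q → x ≡ y) →
  ∀ xs → Unique xs → All P xs → length xs ℕ.≤ N
labelled-pigeonhole {P = P} N label bounded injective xs unique all with N ℕ.<? length xs
... | no  N≮length = ℕP.≮⇒≥ N≮length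
... | yes N<length with pigeonhole N<length code
  where
  code : Fin (length xs) → Fin N
  code i = fromℕ< (bounded _ (All.lookup all (∈-lookup i)))
...   | i , j , i<j , same-code = ⊥-elim (unique-lookup unique i<j (injective _ _ pᵢ pⱼ same-label))
  where
  pᵢ = All.lookup all (∈-lookup i)
  pⱼ = All.lookup all (∈-lookup j)
  same-label : label _ pᵢ ≡ label _ pⱼ
  same-label = trans (sym (toℕ-fromℕ< (bounded _ pᵢ))) (trans (cong toℕ same-code) (toℕ-fromℕ< (bounded _ pⱼ)))

rescale : ∀ d Z Z₀ k → 1 ℕ.≤ d → ι Z₀ ≡ ι Z divℚ (ι (+ d) ^ℚ k) → ι Z ≡ ι (+ d) ^ℚ k * ι Z₀
rescale d Z Z₀ k 1≤d e = sym (trans (cong (ι (+ d) ^ℚ k *_) e) (divℚ-cancel (ι Z) (ι (+ d) ^ℚ k) dᵏ≢0))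
  where
  dᵏ≢0 : ι (+ d) ^ℚ k ≢ 0ℚ
  dᵏ≢0 = ^ℚ-≢0 k (ι-≢0 λ d≡0 → ℕP.<⇒≢ 1≤d (sym (ℤP.+-injective d≡0)))

-- If every scaling factor d arising from S₂(X) is at most K, then every
-- fiber of the map S₃(X) → S(X) has at most K + 1 elements: distinct points of
-- a fiber have distinct scaling factors.
fiber-bound : ∀ f g n m κ K →
  (∀ X a b A B d → InS₂ f g n m κ X a b → ι A ≡ Aval f n m a b → ι B ≡ Bval g n m a b → IsLargest12 A B d → d ℕ.≤ K) →
  ∀ X A₀ B₀ (F : List (ℤ × ℤ)) → Unique F →
  All (λ p → InS₃ f g n m κ X (proj₁ p) (proj₂ p) × MapsTo (proj₁ p) (proj₂ p) A₀ B₀) F → length F ℕ.≤ suc K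
fiber-bound f g n m κ K d≤K X A₀ B₀ = labelled-pigeonhole {P = InFiber} (suc K) scaling bounded same-scaling
  where
  InFiber : ℤ × ℤ → Set
  InFiber p = InS₃ f g n m κ X (proj₁ p) (proj₂ p) × MapsTo (proj₁ p) (proj₂ p) A₀ B₀
  scaling : ∀ p → InFiber p → ℕ
  scaling _ (_ , d , _) = d
  bounded : ∀ p (inF : InFiber p) → scaling p inF ℕ.< suc K
  bounded (A , B) ((a , b , s₂ , eA , eB) , d , largest , _) = ℕ.s≤s (d≤K X a b A B d s₂ eA eB largest)
  same-scaling : ∀ p q (inF : InFiber p) (inF′ : InFiber q) → scaling p inF ≡ scaling q inF′ → p ≡ q
  same-scaling (A , B) (A′ , B′) (_ , d , (1≤d , _) , eA₀ , eB₀) (_ , .d , (1≤d′ , _) , eA₀′ , eB₀′) refl =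
    cong₂ _,_ (ι-injective (trans (rescale d A A₀ 4 1≤d eA₀) (sym (rescale d A′ A₀ 4 1≤d′ eA₀′))))
              (ι-injective (trans (rescale d B B₀ 6 1≤d eB₀) (sym (rescale d B′ B₀ 6 1≤d′ eB₀′))))

largest-divides : ∀ A B d → IsLargest12 A B d → (+ d) ℤ.^ 12 ℤS.∣ A ℤ.^ 3 × (+ d) ℤ.^ 12 ℤS.∣ B ℤ.^ 2
largest-divides A B d (_ , d¹²∣gcd , _) =
  ℤS.∣ᵤ⇒∣ (ℕD.∣-trans d¹²∣gcd (ℤG.gcd[i,j]∣i (A ℤ.^ 3) (B ℤ.^ 2))) ,
  ℤS.∣ᵤ⇒∣ (ℕD.∣-trans d¹²∣gcd (ℤG.gcd[i,j]∣j (A ℤ.^ 3) (B ℤ.^ 2)))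

positive⇒ι≢0 : ∀ {b} → + 0 ℤ.< b → ι b ≢ 0ℚ
positive⇒ι≢0 b>0 e = ℤP.<-irrefl (sym (ι-injective e)) b>0

-- Given an integer Bézout identity, the scaling factor d of any point of S₂
-- is bounded by a constant depending only on f, g, n, m and the identity: the
-- polynomial attaining the maximal weight supplies the bound through its
-- leading coefficient.
module FactorBound (f g : List ℤ) (r s n m′ : ℕ) (deg-f : HasDegree f r) (deg-g : HasDegree g s) (κ : ℚ)
                   (U V : List ℤ) (c : ℚ) (c≢0 : c ≢ 0ℚ)
                   (bezout : ∀ t → eval U t * eval f t + eval V t * eval g t ≡ c) where
  open ScalingBound f g n m′ U V c bezout

  Tight : Set
  Tight = suc m′ ℕ.* r ≡ 4 ℕ.* n ⊎ suc m′ ℕ.* s ≡ 6 ℕ.* n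

  K : List ℤ → ℕ → ℕ → ℕ
  K h r k = C ℕ.* (∣ coeffℤ h r ∣ ℕ.^ k) ℕ.^ L

  K≢0 : ∀ h r k → HasDegree h r → K h r k ≢ 0
  K≢0 h r k (lc≢0 , _) K≡0 with ℕP.m*n≡0⇒m≡0∨n≡0 C K≡0
  ... | inj₁ C≡0    = c≢0 (ℚP.↥p≡0⇒p≡0 c (ℤP.∣i∣≡0⇒i≡0 (ℕP.m^n≡0⇒m≡0 _ 4 C≡0)))
  ... | inj₂ lcᵏᴸ≡0 = lc≢0 (ℤP.∣i∣≡0⇒i≡0 (ℕP.m^n≡0⇒m≡0 _ k (ℕP.m^n≡0⇒m≡0 _ L lcᵏᴸ≡0)))

  Kbound : Tight → ℕ
  Kbound (inj₁ _) = K f r 3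
  Kbound (inj₂ _) = K g s 2

  factor-bound : ∀ (tight : Tight) X a b A B d → InS₂ f g n m κ X a b →
    ι A ≡ Aval f n m a b → ι B ≡ Bval g n m a b → IsLargest12 A B d → d ℕ.≤ Kbound tight
  factor-bound tight X a b A B d (a⊥b , b>0 , _) eA eB largest@(1≤d , _) = by-case tight
    where
    d¹²∣A³ = proj₁ (largest-divides A B d largest)
    d¹²∣B² = proj₂ (largest-divides A B d largest)
    d¹²∣Cbᴸ : d ℕ.^ 12 ∣ C ℕ.* ∣ b ∣ ℕ.^ L
    d¹²∣Cbᴸ = scaling-bound a b A B (positive⇒ι≢0 b>0) eA eB d d¹²∣A³ d¹²∣B²
    via : ∀ h r w k Z → HasDegree h r → suc m′ ℕ.* r ≡ w → ι Z ≡ (ι b ^ℚ w) * eval h (ι a divℚ (ι b ^ℚ m)) →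
          (+ d) ℤ.^ 12 ℤS.∣ Z ℤ.^ k → d ℕ.≤ K h r k
    via h r w k Z deg-h h-tight eZ d¹²∣Zᵏ = ^12-∣⇒≤ d _ 1≤d (K≢0 h r k deg-h)
      (leading-coefficient-bound h r m′ w k C L a b Z d deg-h h-tight (positive⇒ι≢0 b>0) a⊥b eZ d¹²∣Zᵏ d¹²∣Cbᴸ)
    by-case : ∀ tight → d ℕ.≤ Kbound tight
    by-case (inj₁ f-tight) = via f r (4 ℕ.* n) 3 A deg-f f-tight eA d¹²∣A³
    by-case (inj₂ g-tight) = via g s (6 ℕ.* n) 2 B deg-g g-tight eB d¹²∣B²

FibersBounded : List ℤ → List ℤ → ℕ → ℕ → ℚ → Set
FibersBounded f g n m κ = ∃[ N ] (∀ (X : ℚ) → 1ℚ ℚ.≤ X → ∀ A₀ B₀ → InS f g X A₀ B₀ →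
  (F : List (ℤ × ℤ)) → Unique F →
  All (λ p → InS₃ f g n m κ X (proj₁ p) (proj₂ p) × MapsTo (proj₁ p) (proj₂ p) A₀ B₀) F →
  length F ℕ.≤ N)

fibers-bounded : ∀ f g r s n m′ κ → HasDegree f r → HasDegree g s → IntegerBezout f g →
  suc m′ ℕ.* r ≡ 4 ℕ.* n ⊎ suc m′ ℕ.* s ≡ 6 ℕ.* n → FibersBounded f g n (suc m′) κ
fibers-bounded f g r s n m′ κ deg-f deg-g (U , V , c , c≢0 , bezout) tight =
  suc (Kbound tight) , λ X _ A₀ B₀ _ → fiber-bound f g n (suc m′) κ (Kbound tight) (factor-bound tight) X A₀ B₀
  where open FactorBound f g r s n m′ deg-f deg-g κ U V c c≢0 bezout

lemma2p7 : (f g : List ℤ) (r s n m : ℕ) .{{_ : ℕ.NonZero m}} →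
    HasDegree f r → HasDegree g s → CoprimeInℚ[t] f g →
    (0 ℕ.< r ⊎ 0 ℕ.< s) →
    0 ℕ.< n → Coprime n m →
    ((+ r) ℚ./ 4) ⊔ ((+ s) ℚ./ 6) ≡ (+ n) ℚ./ m →
    (n ≡ 1 ⊎ m ≡ 1) →
    (κ : ℚ) → 0ℚ ℚ.< κ →
    (∀ (X : ℚ) → 1ℚ ℚ.≤ X → ∀ a b → InS₂ f g n m κ X a b →
    ∀ A B → ι A ≡ Aval f n m a b → ι B ≡ Bval g n m a b → Bounded X A B) →
    ∃[ N ] (∀ (X : ℚ) → 1ℚ ℚ.≤ X → ∀ A₀ B₀ → InS f g X A₀ B₀ →
    (F : List (ℤ × ℤ)) → Unique F →
    All (λ p → InS₃ f g n m κ X (proj₁ p) (proj₂ p) × MapsTo (proj₁ p) (proj₂ p) A₀ B₀) F →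
    length F ℕ.≤ N)
lemma2p7 f g r s n zero      _ _ _ _ _ _ _ _ _ _ _ = ⊥-elim (ℕ.≢-nonZero⁻¹ 0 refl)
lemma2p7 f g r s n (suc m′) deg-f deg-g coprime _ _ _ max≡ _ κ _ _ =
  fibers-bounded f g r s n m′ κ deg-f deg-g (integerBezout f g s deg-g coprime) (tight-weight r s n m′ max≡)
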